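{- Let $n\ge 1$ and let $K$ be a pure $n$-simplicial complex. Then $K$ is a simplicial tree if and only if $K$ has an $(n-1)$-complete ordering.
   Context: A simplicial complex $K$ on a finite vertex set is a collection of non-empty vertex subsets containing all singletons and closed under taking non-empty subsets; a $k$-simplex has $k+1$ vertices, and $\tau$ is a face of $\sigma$ if $\tau\subseteq\sigma$. $K^k$ is the set of $k$-simplices. $K$ is a pure $n$-simplicial complex if $\dim K=n$ and every simplex of $K$ is a face of some $n$-simplex of $K$. For a set $S$ of simplices, $\overline{S}$ (the closure) is the set of all faces of members of $S$. Let $0\le m\le n-1$. An $(m,n)$-walk sequence between $m$-simplices $\sigma,\sigma'$ is an alternating sequence $\sigma=\sigma_1,\eta_1,\sigma_2,\dots,\sigma_r,\eta_r,\sigma_{r+1}=\sigma'$ of $m$-simplices $\sigma_k$ and $n$-simplices $\eta_k$ of $K$ with $\sigma_k\ne\sigma_{k+1}$ and both faces of $\eta_k$ for $1\le k\le r$. It is an $(m,n)$-path sequence if all simplices in it are distinct. $K$ is connected if there is an $(n-1,n)$-path sequence between every pair of distinct $(n-1)$-simplices of $K$. An $(m,n)$-circuit sequence is an $(m,n)$-walk sequence with $\sigma_{r+1}=\sigma_1$ and $\sigma_p\neq\sigma_q$, $\eta_p\ne\eta_q$ for all $1\le p\ne q\le r$. It is an $(m,n)$-simplicial cycle sequence if moreover (i) $r\ge3$; (ii) $\sigma_1$ is not a face of $\eta_k$ for $2\le k\le r-1$; (iii) for each $2\le z\le r$ there is an $(n-1)$-simplex $\sigma'_z$ of $K$ which is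 a face of both $\eta_{z-1}$ and $\eta_z$ and has $\sigma_z$ as a face, with $\sigma'_x\ne\sigma'_y$ for $2\le x\ne y\le r$. $K$ is acyclic if it contains no $(m,n)$-simplicial cycle sequence for any $0\le m\le n-1$. A simplicial tree is a connected acyclic pure $n$-simplicial complex. For an $n$-simplex $\eta$ of a pure $n$-simplicial complex $L$, the attachment $\mathcal{A}(\eta,L)$ is the subcomplex of all faces $\sigma$ of $\eta$ such that $\sigma$ is a face of some $n$-simplex of $L$ different from $\eta$. $K$ has an $(n-1)$-complete ordering if its $n$-simplices can be listed (each exactly once) as $\eta_1,\dots,\eta_t$, $t=|K^n|$, such that for each $2\le i\le t$, with $K_i=\overline{\{\eta_1,\dots,\eta_i\}}$, the attachment $\mathcal{A}(\eta_i,K_i)$ is a complete simplicial complex on $n$ vertices (i.e. consists of all non-empty subsets of some $n$-element vertex set). -}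

module Defs where

open import Data.Nat using (ℕ; zero; suc; _+_; _∸_; _≤_; _<_)
open import Data.Bool using (Bool; T)
open import Data.Fin using (Fin)
open import Data.Fin.Subset using (Subset; _⊆_; ∣_∣; Nonempty; ⁅_⁆)
open import Data.Product using (Σ; ∃; _×_; _,_)
open import Relation.Binary.PropositionalEquality using (_≡_; _≢_)
open import Relation.Nullary using (¬_)
open import Function.Bundles using (_⇔_)

Complex : ℕ → Set
Complex v = Subset v → Bool

module _ {v : ℕ} (K : Complex v) where

  InK : Subset v → Set
  InK σ = T (K σ)

  Simplex : ℕ → Subset v → Set
  Simplex k σ = InK σ × ∣ σ ∣ ≡ suc k

  record IsComplex : Set where
    field
      nonempty  : ∀ σ → InK σ → Nonempty σ
      singleton : ∀ i → InK ⁅ i ⁆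
      faceClosed : ∀ σ τ → InK σ → Nonempty τ → τ ⊆ σ → InK τ

  record Pure (n : ℕ) : Set where
    field
      hasTop   : ∃ λ η → Simplex n η
      dimBound : ∀ σ → InK σ → ∣ σ ∣ ≤ suc n
      pure     : ∀ σ → InK σ → ∃ λ η → Simplex n η × σ ⊆ η

  -- (m,n)-walk sequence σ_1, η_1, ..., σ_r, η_r, σ_{r+1}, indexed from 1
  -- by functions ℕ → Subset v (values outside the range are irrelevant).
  record IsWalk (m n r : ℕ) (σs ηs : ℕ → Subset v) : Set where
    field
      σ-simp : ∀ k → 1 ≤ k → k ≤ suc r → Simplex m (σs k)
      η-simp : ∀ k → 1 ≤ k → k ≤ r → Simplex n (ηs k)
      step≢  : ∀ k → 1 ≤ k → k ≤ r → σs k ≢ σs (suc k)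
      left⊆  : ∀ k → 1 ≤ k → k ≤ r → σs k ⊆ ηs k
      right⊆ : ∀ k → 1 ≤ k → k ≤ r → σs (suc k) ⊆ ηs k

  -- (m,n)-path sequence between σ and σ' (all simplices distinct; an
  -- m-simplex and an n-simplex are automatically distinct as m < n)
  record PathSeq (m n : ℕ) (σ σ' : Subset v) : Set where
    field
      r    : ℕ
      σs   : ℕ → Subset v
      ηs   : ℕ → Subset v
      walk : IsWalk m n r σs ηs
      start : σs 1 ≡ σ
      end   : σs (suc r) ≡ σ'
      σ-inj : ∀ p q → 1 ≤ p → p ≤ suc r → 1 ≤ q → q ≤ suc r → p ≢ q → σs p ≢ σs q
      η-inj : ∀ p q → 1 ≤ p → p ≤ r → 1 ≤ q → q ≤ r → p ≢ q → ηs p ≢ ηs q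

  Connected : ℕ → Set
  Connected n = ∀ σ σ' → Simplex (n ∸ 1) σ → Simplex (n ∸ 1) σ' → σ ≢ σ' →
                PathSeq (n ∸ 1) n σ σ'

  record CycleSeq (m n : ℕ) : Set where
    field
      r    : ℕ
      σs   : ℕ → Subset v
      ηs   : ℕ → Subset v
      walk : IsWalk m n r σs ηs
      closed : σs (suc r) ≡ σs 1
      σ-inj : ∀ p q → 1 ≤ p → p ≤ r → 1 ≤ q → q ≤ r → p ≢ q → σs p ≢ σs q
      η-inj : ∀ p q → 1 ≤ p → p ≤ r → 1 ≤ q → q ≤ r → p ≢ q → ηs p ≢ ηs q
      r≥3   : 3 ≤ r
      notFace : ∀ k → 2 ≤ k → k ≤ r ∸ 1 → ¬ (σs 1 ⊆ ηs k)
      σ's    : ℕ → Subset v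
      σ'-simp : ∀ z → 2 ≤ z → z ≤ r → Simplex (n ∸ 1) (σ's z)
      σ'-left  : ∀ z → 2 ≤ z → z ≤ r → σ's z ⊆ ηs (z ∸ 1)
      σ'-right : ∀ z → 2 ≤ z → z ≤ r → σ's z ⊆ ηs z
      σ'-has   : ∀ z → 2 ≤ z → z ≤ r → σs z ⊆ σ's z
      σ'-inj   : ∀ x y → 2 ≤ x → x ≤ r → 2 ≤ y → y ≤ r → x ≢ y → σ's x ≢ σ's y

  Acyclic : ℕ → Set
  Acyclic n = ∀ m → m < n → ¬ CycleSeq m n

  record SimplicialTree (n : ℕ) : Set where
    field
      pure      : Pure n
      connected : Connected n
      acyclic   : Acyclic n

  InClosure : (ηs : ℕ → Subset v) → ℕ → Subset v → Set
  InClosure ηs i τ = Nonempty τ × ∃ λ j → 1 ≤ j × j ≤ i × τ ⊆ ηs j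

  InAttachment : (n : ℕ) (ηs : ℕ → Subset v) → ℕ → Subset v → Set
  InAttachment n ηs i σ =
    Nonempty σ × σ ⊆ ηs i ×
    ∃ λ ρ → (InClosure ηs i ρ × ∣ ρ ∣ ≡ suc n) × ρ ≢ ηs i × σ ⊆ ρ

  IsCompleteOn : ℕ → (Subset v → Set) → Set
  IsCompleteOn n A = ∃ λ W → ∣ W ∣ ≡ n × (∀ σ → A σ ⇔ (Nonempty σ × σ ⊆ W))

  record CompleteOrdering (n : ℕ) : Set where
    field
      t    : ℕ
      ηs   : ℕ → Subset v
      simp : ∀ i → 1 ≤ i → i ≤ t → Simplex n (ηs i)
      inj  : ∀ p q → 1 ≤ p → p ≤ t → 1 ≤ q → q ≤ t → p ≢ q → ηs p ≢ ηs q
      surj : ∀ η → Simplex n η → ∃ λ i → 1 ≤ i × i ≤ t × ηs i ≡ η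
      complete : ∀ i → 2 ≤ i → i ≤ t → IsCompleteOn n (InAttachment n ηs i)

-- Write n = d + 1.
--
-- Ordering ⇒ tree.  Facets are joined by paths built along the ordering: each new
-- η_{i+1} meets the earlier simplices exactly in the faces of an (n-1)-simplex W,
-- through which its facets reach the old ones.  In a simplicial cycle sequence,
-- the simplex η_{k₀} coming last in the ordering meets its neighbours inside its
-- attachment, so the two facets σ'_{k₀}, σ'_{k₀+1} (or, at an end of the cycle,
-- σ₁ together with one of them) lie in W; equal sizes force σ'_{k₀} = W = σ'_{k₀+1},
-- or σ₁ ⊆ σ'₂ resp. σ₁ ⊆ σ'_r, contradicting the definition.
--
-- Tree ⇒ ordering.  Choose n-simplices greedily, each new η sharing a facet F with
-- a chosen one (possible by connectivity).  The attachment of η is then exactly the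
-- faces of F: otherwise there is a vertex x ∈ η − F in a chosen simplex, and a
-- gallery of chosen simplices from F to x closes up through η into a loop
-- ρ₀ = η, ρ₁, …, ρₖ.  A shortest such loop, in which x, the crossing facets and
-- chosen vertices bⱼ ∈ Fⱼ − Fⱼ₋₁ allow no shortcut, is a (0,n)-simplicial cycle
-- sequence x, b₀, …, bₖ₋₁, x, contradicting acyclicity.

module Submission where

open import Defs
open import Data.Nat using (ℕ; zero; suc; _+_; _∸_; _≤_; _<_; z≤n; s≤s; s≤s⁻¹; _≤?_; _<?_; _≟_)
open import Data.Nat.Properties
open import Data.Nat.Induction using (<-wellFounded)
open import Data.Bool using (true; false)
import Data.Bool as Bool
open import Data.Fin using (Fin; zero; suc)
open import Data.Fin.Subset
  using (Subset; _⊆_; ∣_∣; Nonempty; ⁅_⁆; _∈_; _∉_; _∩_; _-_; _─_)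
open import Data.Fin.Subset.Properties
open import Data.Fin.Properties using (¬∀⟶∃¬)
open import Data.Product using (∃; _×_; _,_; proj₁; proj₂)
open import Data.Sum using (_⊎_; inj₁; inj₂; [_,_]′)
open import Data.Empty using (⊥; ⊥-elim)
open import Data.Vec using ([]; _∷_; here; there)
import Data.List as List
import Data.List.Membership.Propositional as List
open import Data.List.Relation.Unary.Any using (here; there)
open import Data.List.Membership.Propositional.Properties using (∈-++⁺ˡ; ∈-++⁺ʳ; ∈-map⁺)
open import Data.Vec.Properties using (≡-dec)
open import Induction.WellFounded using (Acc; acc)
open import Relation.Binary.PropositionalEquality
  using (_≡_; _≢_; refl; sym; trans; cong; subst)
open import Relation.Binary using (tri<; tri≈; tri>)
open import Relation.Nullary using (¬_; ¬?; Dec; yes; no; _×-dec_; _→-dec_)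
open import Relation.Nullary.Decidable using (T?)
import Relation.Nullary.Decidable as Dec
open import Function using (_∘_; id)
open import Function.Bundles using (_⇔_; mk⇔; Equivalence)

private variable m : ℕ

-- Finite sets

_≟ˢ_ : (p q : Subset m) → Dec (p ≡ q)
_≟ˢ_ = ≡-dec Bool._≟_

p⊈q⇒∃∈∉ : {p q : Subset m} → ¬ p ⊆ q → ∃ λ x → x ∈ p × x ∉ q
p⊈q⇒∃∈∉ {m} {p} {q} p⊈q with ¬∀⟶∃¬ m _ (λ x → x ∈? p →-dec x ∈? q) (λ h → p⊈q (h _))
... | x , ¬[x∈p⇒x∈q] with x ∈? p
...   | yes x∈p = x , x∈p , λ x∈q → ¬[x∈p⇒x∈q] (λ _ → x∈q)
...   | no x∉p = ⊥-elim (¬[x∈p⇒x∈q] (λ x∈p → ⊥-elim (x∉p x∈p)))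

p⊆q∧∣q∣≤∣p∣⇒p≡q : {p q : Subset m} → p ⊆ q → ∣ q ∣ ≤ ∣ p ∣ → p ≡ q
p⊆q∧∣q∣≤∣p∣⇒p≡q {p = p} {q} p⊆q ∣q∣≤∣p∣ with q ⊆? p
... | yes q⊆p = ⊆-antisym p⊆q q⊆p
... | no q⊈p = ⊥-elim (<⇒≱ (p⊂q⇒∣p∣<∣q∣ (p⊆q , p⊈q⇒∃∈∉ q⊈p)) ∣q∣≤∣p∣)

⊆-same-size⇒≡ : ∀ {k} {p q : Subset m} → ∣ p ∣ ≡ k → ∣ q ∣ ≡ k → p ⊆ q → p ≡ q
⊆-same-size⇒≡ refl ∣q∣≡∣p∣ p⊆q = p⊆q∧∣q∣≤∣p∣⇒p≡q p⊆q (≤-reflexive ∣q∣≡∣p∣)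

∣p∣≡1+k⇒Nonempty : ∀ {k} {p : Subset m} → ∣ p ∣ ≡ suc k → Nonempty p
∣p∣≡1+k⇒Nonempty {m} {p = p} ∣p∣≡1+k with nonempty? p
... | yes ne = ne
... | no ¬ne with () ← trans (sym ∣p∣≡1+k) (trans (cong ∣_∣ (Empty-unique ¬ne)) (∣⊥∣≡0 m))

x∈p⇒∣p-x∣+1≡∣p∣ : ∀ {x} (p : Subset m) → x ∈ p → suc ∣ p - x ∣ ≡ ∣ p ∣
x∈p⇒∣p-x∣+1≡∣p∣ {x = zero} (true ∷ p) here = cong (λ q → suc ∣ q ∣) (p─⊥≡p p)
x∈p⇒∣p-x∣+1≡∣p∣ {x = suc x} (true ∷ p) (there x∈p) = cong suc (x∈p⇒∣p-x∣+1≡∣p∣ p x∈p)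
x∈p⇒∣p-x∣+1≡∣p∣ {x = suc x} (false ∷ p) (there x∈p) = x∈p⇒∣p-x∣+1≡∣p∣ p x∈p

⁅⁆-injective : {x y : Fin m} → ⁅ x ⁆ ≡ ⁅ y ⁆ → x ≡ y
⁅⁆-injective {x = x} {y} ⁅x⁆≡⁅y⁆ = x∈⁅y⁆⇒x≡y y (subst (x ∈_) ⁅x⁆≡⁅y⁆ (x∈⁅x⁆ x))

x∈p⇒⁅x⁆⊆p : {x : Fin m} {p : Subset m} → x ∈ p → ⁅ x ⁆ ⊆ p
x∈p⇒⁅x⁆⊆p {x = x} x∈p y∈⁅x⁆ rewrite x∈⁅y⁆⇒x≡y x y∈⁅x⁆ = x∈p

x∈p─q⇒x∉q : ∀ {x} (p q : Subset m) → x ∈ p ─ q → x ∉ q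
x∈p─q⇒x∉q (true ∷ p) (false ∷ q) here ()
x∈p─q⇒x∉q (_ ∷ p) (true ∷ q) (there x∈p─q) (there x∈q) = x∈p─q⇒x∉q p q x∈p─q x∈q
x∈p─q⇒x∉q (_ ∷ p) (false ∷ q) (there x∈p─q) (there x∈q) = x∈p─q⇒x∉q p q x∈p─q x∈q

-- A total choice function, so that chosen elements can be named before
-- the proof that the set is non-empty is available.
choose : Subset m → Fin m → Fin m
choose p default with nonempty? p
... | yes (x , _) = x
... | no _ = default

choose-∈ : (p : Subset m) (default : Fin m) → Nonempty p → choose p default ∈ p
choose-∈ p default ne with nonempty? p
... | yes (_ , x∈p) = x∈p
... | no ¬ne = ⊥-elim (¬ne ne)

⊇-facet-and-point⇒≡ : ∀ {k} {W A B : Subset m} {x} →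
  ∣ W ∣ ≡ k → ∣ A ∣ ≡ suc k → ∣ B ∣ ≡ suc k →
  W ⊆ A → W ⊆ B → x ∈ A → x ∈ B → x ∉ W → A ≡ B
⊇-facet-and-point⇒≡ {W = W} {A} {B} refl ∣A∣ ∣B∣ W⊆A W⊆B x∈A x∈B x∉W =
  trans (sym (p⊆q∧∣q∣≤∣p∣⇒p≡q (p∩q⊆p A B) (subst (_≤ ∣ A ∩ B ∣) (sym ∣A∣) ∣W∣<∣A∩B∣)))
        (p⊆q∧∣q∣≤∣p∣⇒p≡q (p∩q⊆q A B) (subst (_≤ ∣ A ∩ B ∣) (sym ∣B∣) ∣W∣<∣A∩B∣))
  where
  ∣W∣<∣A∩B∣ : ∣ W ∣ < ∣ A ∩ B ∣
  ∣W∣<∣A∩B∣ = p⊂q⇒∣p∣<∣q∣ ((λ w → x∈p∩q⁺ (W⊆A w , W⊆B w)) , _ , x∈p∩q⁺ (x∈A , x∈B) , x∉W)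

allSubsets : ∀ m → List.List (Subset m)
allSubsets zero = List.[ [] ]
allSubsets (suc m) = List.map (true ∷_) (allSubsets m) List.++ List.map (false ∷_) (allSubsets m)

∈-allSubsets : (p : Subset m) → p List.∈ allSubsets m
∈-allSubsets [] = here refl
∈-allSubsets {suc m} (true ∷ p) = ∈-++⁺ˡ (∈-map⁺ (true ∷_) (∈-allSubsets p))
∈-allSubsets {suc m} (false ∷ p) = ∈-++⁺ʳ (List.map (true ∷_) (allSubsets m)) (∈-map⁺ (false ∷_) (∈-allSubsets p))

-- Counting and bounded search

module _ {A : Set} {P Q : A → Set} (P? : ∀ x → Dec (P x)) (Q? : ∀ x → Dec (Q x)) (Q⇒P : ∀ x → Q x → P x) where

  length-filter-mono : ∀ xs → List.length (List.filter Q? xs) ≤ List.length (List.filter P? xs)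
  length-filter-mono List.[] = z≤n
  length-filter-mono (x List.∷ xs) with Q? x | P? x
  ... | yes _ | yes _ = s≤s (length-filter-mono xs)
  ... | yes Qx | no ¬Px = ⊥-elim (¬Px (Q⇒P x Qx))
  ... | no _ | yes _ = m≤n⇒m≤1+n (length-filter-mono xs)
  ... | no _ | no _ = length-filter-mono xs

  length-filter-mono-< : ∀ {y} xs → y List.∈ xs → P y → ¬ Q y →
                         List.length (List.filter Q? xs) < List.length (List.filter P? xs)
  length-filter-mono-< (x List.∷ xs) (here refl) Px ¬Qx with Q? x | P? x
  ... | yes Qx | _ = ⊥-elim (¬Qx Qx)
  ... | no _ | yes _ = s≤s (length-filter-mono xs)
  ... | no _ | no ¬Px = ⊥-elim (¬Px Px)
  length-filter-mono-< (x List.∷ xs) (there y∈xs) Py ¬Qy with Q? x | P? x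
  ... | yes _ | yes _ = s≤s (length-filter-mono-< xs y∈xs Py ¬Qy)
  ... | yes Qx | no ¬Px = ⊥-elim (¬Px (Q⇒P x Qx))
  ... | no _ | yes _ = m≤n⇒m≤1+n (length-filter-mono-< xs y∈xs Py ¬Qy)
  ... | no _ | no _ = length-filter-mono-< xs y∈xs Py ¬Qy

between? : {P : ℕ → Set} → (∀ j → Dec (P j)) → ∀ a b → Dec (∃ λ j → a ≤ j × j ≤ b × P j)
between? P? a b = Dec.map′
  (λ { (j , j<1+b , a≤j , Pj) → j , a≤j , <⇒≤pred j<1+b , Pj })
  (λ { (j , a≤j , j≤b , Pj) → j , s≤s j≤b , a≤j , Pj })
  (anyUpTo? (λ j → a ≤? j ×-dec P? j) (suc b))

injective-on-range : ∀ {A : Set} (f : ℕ → A) (a b : ℕ) →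
  (∀ p q → a ≤ p → p < q → q ≤ b → f p ≢ f q) →
  ∀ p q → a ≤ p → p ≤ b → a ≤ q → q ≤ b → p ≢ q → f p ≢ f q
injective-on-range f a b inj< p q a≤p p≤b a≤q q≤b p≢q with <-cmp p q
... | tri< p<q _ _ = inj< p q a≤p p<q q≤b
... | tri≈ _ p≡q _ = ⊥-elim (p≢q p≡q)
... | tri> _ _ q<p = λ fp≡fq → inj< q p a≤q q<p p≤b (sym fp≡fq)

≤1+n⇒≤n⊎≡1+n : ∀ {j n} → j ≤ suc n → j ≤ n ⊎ j ≡ suc n
≤1+n⇒≤n⊎≡1+n j≤1+n with m≤n⇒m<n∨m≡n j≤1+n
... | inj₁ j<1+n = inj₁ (s≤s⁻¹ j<1+n)
... | inj₂ j≡1+n = inj₂ j≡1+n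

argmax : (f : ℕ → ℕ) (r : ℕ) → 1 ≤ r →
  ∃ λ k → 1 ≤ k × k ≤ r × ∀ j → 1 ≤ j → j ≤ r → f j ≤ f k
argmax f (suc zero) _ = 1 , ≤-refl , ≤-refl , λ j 1≤j j≤1 → ≤-reflexive (cong f (≤-antisym j≤1 1≤j))
argmax f (suc (suc r)) _ with argmax f (suc r) (s≤s z≤n)
... | k , 1≤k , k≤1+r , max with f k ≤? f (suc (suc r))
...   | yes fk≤ = suc (suc r) , s≤s z≤n , ≤-refl , bound
  where
  bound : ∀ j → 1 ≤ j → j ≤ suc (suc r) → f j ≤ f (suc (suc r))
  bound j 1≤j j≤ with ≤1+n⇒≤n⊎≡1+n j≤
  ... | inj₁ j≤1+r = ≤-trans (max j 1≤j j≤1+r) fk≤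
  ... | inj₂ refl = ≤-refl
...   | no fk≰ = k , 1≤k , m≤n⇒m≤1+n k≤1+r , bound
  where
  bound : ∀ j → 1 ≤ j → j ≤ suc (suc r) → f j ≤ f k
  bound j 1≤j j≤ with ≤1+n⇒≤n⊎≡1+n j≤
  ... | inj₁ j≤1+r = max j 1≤j j≤1+r
  ... | inj₂ refl = <⇒≤ (≰⇒> fk≰)

-- Loops of simplices and simplicial cycles

module _ {v : ℕ} (K : Complex v) (d : ℕ) where

  record Loop (k : ℕ) : Set where
    field
      ρ F : ℕ → Subset v
      x : Fin v
      1≤k : 1 ≤ k
      ρ-simplex : ∀ j → j ≤ k → Simplex K (suc d) (ρ j)
      ρ≢ρ₀ : ∀ j → 1 ≤ j → j ≤ k → ρ j ≢ ρ 0
      F-simplex : ∀ j → j < k → Simplex K d (F j)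
      F⊆ρ : ∀ j → j < k → F j ⊆ ρ j
      F⊆ρ-suc : ∀ j → j < k → F j ⊆ ρ (suc j)
      x∈ρ₀ : x ∈ ρ 0
      x∈ρₖ : x ∈ ρ k
      x∉F₀ : x ∉ F 0

  module _ {k : ℕ} (L : Loop k) where
    open Loop L

    truncate-loop : ∀ j → 1 ≤ j → j ≤ k → x ∈ ρ j → Loop j
    truncate-loop j 1≤j j≤k x∈ρⱼ = record
      { ρ = ρ ; F = F ; x = x ; 1≤k = 1≤j
      ; ρ-simplex = λ s s≤j → ρ-simplex s (≤-trans s≤j j≤k)
      ; ρ≢ρ₀ = λ s 1≤s s≤j → ρ≢ρ₀ s 1≤s (≤-trans s≤j j≤k)
      ; F-simplex = λ s s<j → F-simplex s (<-≤-trans s<j j≤k)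
      ; F⊆ρ = λ s s<j → F⊆ρ s (<-≤-trans s<j j≤k)
      ; F⊆ρ-suc = λ s s<j → F⊆ρ-suc s (<-≤-trans s<j j≤k)
      ; x∈ρ₀ = x∈ρ₀ ; x∈ρₖ = x∈ρⱼ ; x∉F₀ = x∉F₀ }

    -- A vertex y ∈ ρₗ ∩ ρⱼ outside Fⱼ₋₁ closes the reversed gallery ρⱼ ρⱼ₋₁ … ρₗ.
    reverse-loop : ∀ j l y → l < j → j ≤ k → (∀ i → i < j → ρ i ≢ ρ j) →
              y ∈ ρ j → y ∈ ρ l → y ∉ F (j ∸ 1) → Loop (j ∸ l)
    reverse-loop j l y l<j j≤k ρᵢ≢ρⱼ y∈ρⱼ y∈ρₗ y∉Fⱼ₋₁ = record
      { ρ = λ s → ρ (j ∸ s) ; F = λ s → F (j ∸ suc s) ; x = y ; 1≤k = m<n⇒0<n∸m l<j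
      ; ρ-simplex = λ s _ → ρ-simplex (j ∸ s) (≤-trans (m∸n≤m j s) j≤k)
      ; ρ≢ρ₀ = λ s 1≤s s≤j∸l → ρᵢ≢ρⱼ (j ∸ s) (∸-monoʳ-< 1≤s (≤-trans s≤j∸l (m∸n≤m j l)))
      ; F-simplex = λ s s<j∸l → F-simplex (j ∸ suc s) (below s s<j∸l)
      ; F⊆ρ = λ s s<j∸l → subst (λ t → F (j ∸ suc s) ⊆ ρ t) (suc[j∸1+s] s s<j∸l)
                             (F⊆ρ-suc (j ∸ suc s) (below s s<j∸l))
      ; F⊆ρ-suc = λ s s<j∸l → F⊆ρ (j ∸ suc s) (below s s<j∸l)
      ; x∈ρ₀ = y∈ρⱼ
      ; x∈ρₖ = subst (λ t → y ∈ ρ t) (sym (m∸[m∸n]≡n (<⇒≤ l<j))) y∈ρₗ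
      ; x∉F₀ = y∉Fⱼ₋₁ }
      where
      1+s≤j : ∀ s → s < j ∸ l → suc s ≤ j
      1+s≤j s s<j∸l = ≤-trans s<j∸l (m∸n≤m j l)
      below : ∀ s → s < j ∸ l → j ∸ suc s < k
      below s s<j∸l = <-≤-trans (∸-monoʳ-< (s≤s z≤n) (1+s≤j s s<j∸l)) j≤k
      suc[j∸1+s] : ∀ s → s < j ∸ l → suc (j ∸ suc s) ≡ j ∸ s
      suc[j∸1+s] s s<j∸l = sym (+-∸-assoc 1 (1+s≤j s s<j∸l))

    -- Fᵢ ⊆ ρᵢ₊₁₊ₑ lets the gallery jump over ρᵢ₊₁ … ρᵢ₊ₑ.
    skip-loop : ∀ i e → 1 ≤ e → suc i + e ≤ k → F i ⊆ ρ (suc i + e) → Loop (k ∸ e)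
    skip-loop i e 1≤e 1+i+e≤k Fᵢ⊆ρ = record
      { ρ = ρ ∘ g ; F = F ∘ g ; x = x ; 1≤k = ≤-trans (s≤s z≤n) 1+i≤k∸e
      ; ρ-simplex = λ s s≤k∸e → ρ-simplex (g s) (g-≤ s s≤k∸e)
      ; ρ≢ρ₀ = λ s 1≤s s≤k∸e → ρ≢ρ₀ (g s) (≤-trans 1≤s (s≤g s)) (g-≤ s s≤k∸e)
      ; F-simplex = λ s s<k∸e → F-simplex (g s) (g-< s s<k∸e)
      ; F⊆ρ = λ s s<k∸e → F⊆ρ (g s) (g-< s s<k∸e)
      ; F⊆ρ-suc = F⊆ρ-suc∘g
      ; x∈ρ₀ = x∈ρ₀
      ; x∈ρₖ = subst (λ t → x ∈ ρ t) (sym g[k∸e]≡k) x∈ρₖ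
      ; x∉F₀ = x∉F₀ }
      where
      e≤k : e ≤ k
      e≤k = m+n≤o⇒n≤o (suc i) 1+i+e≤k
      1+i≤k∸e : suc i ≤ k ∸ e
      1+i≤k∸e = m+n≤o⇒m≤o∸n (suc i) 1+i+e≤k

      shift : ∀ {s} → Dec (s ≤ i) → ℕ
      shift {s} (yes _) = s
      shift {s} (no _) = s + e

      g : ℕ → ℕ
      g s = shift (s ≤? i)

      s≤g : ∀ s → s ≤ g s
      s≤g s with s ≤? i
      ... | yes _ = ≤-refl
      ... | no _ = m≤m+n s e

      g-≤ : ∀ s → s ≤ k ∸ e → g s ≤ k
      g-≤ s s≤k∸e with s ≤? i
      ... | yes _ = ≤-trans s≤k∸e (m∸n≤m k e)
      ... | no _ = m≤o∸n⇒m+n≤o s e≤k s≤k∸e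

      g-< : ∀ s → s < k ∸ e → g s < k
      g-< s s<k∸e with s ≤? i
      ... | yes s≤i = <-≤-trans (s≤s s≤i) (m+n≤o⇒m≤o (suc i) 1+i+e≤k)
      ... | no _ = m≤o∸n⇒m+n≤o (suc s) e≤k s<k∸e

      g[k∸e]≡k : g (k ∸ e) ≡ k
      g[k∸e]≡k with k ∸ e ≤? i
      ... | yes k∸e≤i = ⊥-elim (<⇒≱ 1+i≤k∸e k∸e≤i)
      ... | no _ = m∸n+n≡m e≤k

      F⊆ρ-suc∘g : ∀ s → s < k ∸ e → F (g s) ⊆ ρ (g (suc s))
      F⊆ρ-suc∘g s s<k∸e with s ≤? i | suc s ≤? i
      ... | yes _ | yes _ = F⊆ρ-suc s (<-≤-trans s<k∸e (m∸n≤m k e))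
      ... | yes s≤i | no 1+s≰i with refl ← ≤-antisym s≤i (s≤s⁻¹ (≰⇒> 1+s≰i)) = Fᵢ⊆ρ
      ... | no s≰i | yes 1+s≤i = ⊥-elim (s≰i (≤-trans (n≤1+n s) 1+s≤i))
      ... | no _ | no _ = F⊆ρ-suc (s + e) (m≤o∸n⇒m+n≤o (suc s) e≤k s<k∸e)

    -- Vertices bⱼ ∈ Fⱼ − Fⱼ₋₁ (and b₀ ∈ F₀): the vertices of the cycle sequence.
    b : ℕ → Fin v
    b zero = choose (F 0) x
    b (suc j) = choose (F (suc j) ─ F j) x

    length≥2 : 2 ≤ k
    length≥2 with m≤n⇒m<n∨m≡n 1≤k
    ... | inj₁ 1<k = 1<k
    ... | inj₂ refl = ⊥-elim (ρ≢ρ₀ 1 ≤-refl ≤-refl (sym (⊇-facet-and-point⇒≡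
            (proj₂ (F-simplex 0 ≤-refl)) (proj₂ (ρ-simplex 0 z≤n)) (proj₂ (ρ-simplex 1 ≤-refl))
            (F⊆ρ 0 ≤-refl) (F⊆ρ-suc 0 ≤-refl) x∈ρ₀ x∈ρₖ x∉F₀)))

    -- A loop to which neither truncate-loop nor skip-loop applies.
    module Tight (x∉ρ : ∀ j → 1 ≤ j → j < k → x ∉ ρ j)
                 (F⊈ρ : ∀ i j → suc (suc i) ≤ j → j ≤ k → ¬ F i ⊆ ρ j) where

      ρ-injective : ∀ i j → i < j → j ≤ k → ρ i ≢ ρ j
      ρ-injective zero j 0<j j≤k = ρ≢ρ₀ j 0<j j≤k ∘ sym
      ρ-injective (suc i) j i<j j≤k ρᵢ≡ρⱼ =
        F⊈ρ i j i<j j≤k (subst (F i ⊆_) ρᵢ≡ρⱼ (F⊆ρ-suc i (<⇒≤ (<-≤-trans i<j j≤k))))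

      F-injective : ∀ i j → i < j → j < k → F i ≢ F j
      F-injective i j i<j j<k Fᵢ≡Fⱼ =
        F⊈ρ i (suc j) (s≤s i<j) j<k (subst (_⊆ ρ (suc j)) (sym Fᵢ≡Fⱼ) (F⊆ρ-suc j j<k))

      F⊈F-pred : ∀ j → suc j < k → ¬ F (suc j) ⊆ F j
      F⊈F-pred j 1+j<k F₁₊ⱼ⊆Fⱼ = F-injective j (suc j) ≤-refl 1+j<k (sym
        (⊆-same-size⇒≡ (proj₂ (F-simplex (suc j) 1+j<k)) (proj₂ (F-simplex j (<-trans (n<1+n j) 1+j<k)))
          F₁₊ⱼ⊆Fⱼ))

      b∈F─F-pred : ∀ j → suc j < k → b (suc j) ∈ F (suc j) ─ F j
      b∈F─F-pred j 1+j<k with (y , y∈F₁₊ⱼ , y∉Fⱼ) ← p⊈q⇒∃∈∉ (F⊈F-pred j 1+j<k) =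
        choose-∈ (F (suc j) ─ F j) x (y , x∈p∧x∉q⇒x∈p─q y∈F₁₊ⱼ y∉Fⱼ)

      b∉F-pred : ∀ j → suc j < k → b (suc j) ∉ F j
      b∉F-pred j 1+j<k = x∈p─q⇒x∉q (F (suc j)) (F j) (b∈F─F-pred j 1+j<k)

      b∈F : ∀ j → j < k → b j ∈ F j
      b∈F zero 0<k = choose-∈ (F 0) x (∣p∣≡1+k⇒Nonempty (proj₂ (F-simplex 0 0<k)))
      b∈F (suc j) 1+j<k = p─q⊆p (F (suc j)) (F j) (b∈F─F-pred j 1+j<k)

      b∈ρ : ∀ j → j < k → b j ∈ ρ j
      b∈ρ j j<k = F⊆ρ j j<k (b∈F j j<k)

      b∈ρ-suc : ∀ j → j < k → b j ∈ ρ (suc j)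
      b∈ρ-suc j j<k = F⊆ρ-suc j j<k (b∈F j j<k)

      module _ (isC : IsComplex K) (2≤k : 2 ≤ k)
               (b∉ρ : ∀ j l → l < j → j < k → b j ∉ ρ l) where

        vertex : ∀ {j} → Dec (j < k) → Fin v
        vertex {j} (yes _) = b j
        vertex (no _) = x

        -- The cycle x, b₀, b₁, …, bₖ₋₁, x through ρ₀, ρ₁, …, ρₖ, crossing F₀, …, Fₖ₋₁.
        c : ℕ → Fin v
        c (suc (suc j)) = vertex (j <? k)
        c _ = x

        c≡b : ∀ j → j < k → c (suc (suc j)) ≡ b j
        c≡b j j<k with j <? k
        ... | yes _ = refl
        ... | no j≮k = ⊥-elim (j≮k j<k)

        c-closed : c (suc (suc k)) ≡ x
        c-closed with k <? k
        ... | yes k<k = ⊥-elim (<-irrefl refl k<k)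
        ... | no _ = refl

        x≢b : ∀ j → j < k → x ≢ b j
        x≢b zero 0<k x≡b₀ = x∉F₀ (subst (_∈ F 0) (sym x≡b₀) (b∈F 0 0<k))
        x≢b (suc j) 1+j<k x≡b = x∉ρ (suc j) (s≤s z≤n) 1+j<k (subst (_∈ ρ (suc j)) (sym x≡b) (b∈ρ (suc j) 1+j<k))

        c-injective : ∀ p q → 1 ≤ p → p < q → q ≤ suc k → c p ≢ c q
        c-injective (suc zero) (suc (suc j)) _ _ q≤1+k x≡c =
          x≢b j (s≤s⁻¹ q≤1+k) (trans x≡c (c≡b j (s≤s⁻¹ q≤1+k)))
        c-injective (suc (suc i)) (suc (suc j)) _ p<q q≤1+k cₚ≡c_q = b∉ρ j i (s≤s⁻¹ (s≤s⁻¹ p<q)) j<k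
          (subst (_∈ ρ i) (trans (sym (c≡b i i<k)) (trans cₚ≡c_q (c≡b j j<k))) (b∈ρ i i<k))
          where
          j<k = s≤s⁻¹ q≤1+k
          i<k = <-trans (s≤s⁻¹ (s≤s⁻¹ p<q)) j<k
        c-injective (suc zero) (suc zero) _ (s≤s ()) _
        c-injective (suc (suc _)) (suc zero) _ (s≤s ()) _

        σs ηs σ's : ℕ → Subset v
        σs s = ⁅ c s ⁆
        ηs s = ρ (s ∸ 1)
        σ's z = F (z ∸ 2)

        σ-injective : ∀ p q → 1 ≤ p → p ≤ suc k → 1 ≤ q → q ≤ suc k → p ≢ q → σs p ≢ σs q
        σ-injective = injective-on-range σs 1 (suc k)
          λ p q 1≤p p<q q≤1+k → c-injective p q 1≤p p<q q≤1+k ∘ ⁅⁆-injective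

        step≢ : ∀ s → 1 ≤ s → s ≤ suc k → σs s ≢ σs (suc s)
        step≢ s 1≤s s≤1+k with ≤1+n⇒≤n⊎≡1+n s≤1+k
        ... | inj₁ s≤k = σ-injective s (suc s) 1≤s (m≤n⇒m≤1+n s≤k) (s≤s z≤n) (s≤s s≤k) (<⇒≢ (n<1+n s))
        ... | inj₂ refl = λ σ₁₊ₖ≡σ₂₊ₖ → σ-injective (suc k) 1 1≤s ≤-refl ≤-refl (s≤s z≤n)
                            (>⇒≢ (s≤s (≤-trans (s≤s z≤n) 2≤k))) (trans σ₁₊ₖ≡σ₂₊ₖ (cong ⁅_⁆ c-closed))

        left⊆ : ∀ s → 1 ≤ s → s ≤ suc k → σs s ⊆ ηs s
        left⊆ (suc zero) _ _ = x∈p⇒⁅x⁆⊆p x∈ρ₀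
        left⊆ (suc (suc j)) _ 2+j≤1+k =
          x∈p⇒⁅x⁆⊆p (subst (_∈ ρ (suc j)) (sym (c≡b j j<k)) (b∈ρ-suc j j<k))
          where j<k = s≤s⁻¹ 2+j≤1+k

        right⊆ : ∀ s → 1 ≤ s → s ≤ suc k → σs (suc s) ⊆ ηs s
        right⊆ (suc j) _ j≤k with j <? k
        ... | yes j<k = x∈p⇒⁅x⁆⊆p (b∈ρ j j<k)
        ... | no j≮k with refl ← ≤-antisym (s≤s⁻¹ j≤k) (≮⇒≥ j≮k) = x∈p⇒⁅x⁆⊆p x∈ρₖ

        η-injective : ∀ p q → 1 ≤ p → p < q → q ≤ suc k → ηs p ≢ ηs q
        η-injective (suc p) (suc q) _ p<q q≤k = ρ-injective p q (s≤s⁻¹ p<q) (s≤s⁻¹ q≤k)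

        σ'-injective : ∀ p q → 2 ≤ p → p < q → q ≤ suc k → σ's p ≢ σ's q
        σ'-injective (suc (suc i)) (suc (suc j)) (s≤s (s≤s _)) p<q@(s≤s (s≤s _)) q≤1+k =
          F-injective i j (s≤s⁻¹ (s≤s⁻¹ p<q)) (s≤s⁻¹ q≤1+k)

        cycle : CycleSeq K 0 (suc d)
        cycle = record
          { r = suc k ; σs = σs ; ηs = ηs
          ; walk = record
            { σ-simp = λ s _ _ → IsComplex.singleton isC (c s) , ∣⁅x⁆∣≡1 (c s)
            ; η-simp = λ { (suc s) _ s≤k → ρ-simplex s (s≤s⁻¹ s≤k) }
            ; step≢ = step≢ ; left⊆ = left⊆ ; right⊆ = right⊆ }
          ; closed = cong ⁅_⁆ c-closed
          ; σ-inj = σ-injective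
          ; η-inj = injective-on-range ηs 1 (suc k) η-injective
          ; r≥3 = s≤s 2≤k
          ; notFace = λ { (suc z) (s≤s 1≤z) z<k ⁅x⁆⊆ρ → x∉ρ z 1≤z z<k (⁅x⁆⊆ρ (x∈⁅x⁆ x)) }
          ; σ's = σ's
          ; σ'-simp = λ { (suc (suc j)) (s≤s (s≤s _)) 2+j≤1+k → F-simplex j (s≤s⁻¹ 2+j≤1+k) }
          ; σ'-left = λ { (suc (suc j)) (s≤s (s≤s _)) 2+j≤1+k → F⊆ρ j (s≤s⁻¹ 2+j≤1+k) }
          ; σ'-right = λ { (suc (suc j)) (s≤s (s≤s _)) 2+j≤1+k → F⊆ρ-suc j (s≤s⁻¹ 2+j≤1+k) }
          ; σ'-has = λ { (suc (suc j)) (s≤s (s≤s _)) 2+j≤1+k →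
              x∈p⇒⁅x⁆⊆p (subst (_∈ F j) (sym (c≡b j (s≤s⁻¹ 2+j≤1+k))) (b∈F j (s≤s⁻¹ 2+j≤1+k))) }
          ; σ'-inj = injective-on-range σ's 2 (suc k) σ'-injective
          }

      shortcut-or-cycle : IsComplex K → (∃ λ k' → k' < k × Loop k') ⊎ CycleSeq K 0 (suc d)
      shortcut-or-cycle isC with anyUpTo? (λ j → anyUpTo? (λ l → b j ∈? ρ l) j) k
      ... | yes (suc j , 1+j<k , l , l<1+j , b∈ρₗ) =
            inj₁ (suc j ∸ l , ≤-<-trans (m∸n≤m (suc j) l) 1+j<k ,
                  reverse-loop (suc j) l (b (suc j)) l<1+j (<⇒≤ 1+j<k)
                    (λ i i<1+j → ρ-injective i (suc j) i<1+j (<⇒≤ 1+j<k))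
                    (b∈ρ (suc j) 1+j<k) b∈ρₗ (b∉F-pred j 1+j<k))
      ... | no ¬b∈ρ = inj₂ (cycle isC length≥2 λ j l l<j j<k b∈ρₗ → ¬b∈ρ (j , j<k , l , l<j , b∈ρₗ))


    shorter-or-cycle : IsComplex K → (∃ λ k' → k' < k × Loop k') ⊎ CycleSeq K 0 (suc d)
    shorter-or-cycle isC with anyUpTo? (λ j → 1 ≤? j ×-dec x ∈? ρ j) k
    ... | yes (j , j<k , 1≤j , x∈ρⱼ) = inj₁ (j , j<k , truncate-loop j 1≤j (<⇒≤ j<k) x∈ρⱼ)
    ... | no ¬x∈ρ with anyUpTo? (λ i → anyUpTo? (λ j → suc (suc i) ≤? j ×-dec F i ⊆? ρ j) (suc k)) k
    ...   | yes (i , _ , j , j<1+k , 2+i≤j , Fᵢ⊆ρⱼ) =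
            inj₁ (k ∸ e , ∸-monoʳ-< 1≤e e≤k ,
                  skip-loop i e 1≤e (subst (_≤ k) (sym 1+i+e≡j) (s≤s⁻¹ j<1+k))
                    (subst (λ t → F i ⊆ ρ t) (sym 1+i+e≡j) Fᵢ⊆ρⱼ))
      where
      e = j ∸ suc i
      1≤e = m<n⇒0<n∸m 2+i≤j
      e≤k = ≤-trans (m∸n≤m j (suc i)) (s≤s⁻¹ j<1+k)
      1+i+e≡j = m+[n∸m]≡n (<⇒≤ 2+i≤j)
    ...   | no ¬F⊆ρ = Tight.shortcut-or-cycle
            (λ j 1≤j j<k x∈ρⱼ → ¬x∈ρ (j , j<k , 1≤j , x∈ρⱼ))
            (λ i j 2+i≤j j≤k Fᵢ⊆ρⱼ → ¬F⊆ρ (i , <⇒≤ (≤-trans 2+i≤j j≤k) , j , s≤s j≤k , 2+i≤j , Fᵢ⊆ρⱼ))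
            isC

  loop⇒cycle : IsComplex K → ∀ {k} → Loop k → CycleSeq K 0 (suc d)
  loop⇒cycle isC L = go L (<-wellFounded _)
    where
    go : ∀ {k} → Loop k → Acc _<_ k → CycleSeq K 0 (suc d)
    go L (acc shorter) with shorter-or-cycle L isC
    ... | inj₁ (_ , k'<k , L') = go L' (shorter k'<k)
    ... | inj₂ cycle = cycle

-- Galleries

module _ {v : ℕ} (K : Complex v) (d : ℕ) where

  _◂_ : Subset v → (ℕ → Subset v) → ℕ → Subset v
  (a ◂ f) zero = a
  (a ◂ f) (suc j) = f j

  module _ (η : Subset v) where

    Avoiding : Subset v → Set
    Avoiding A = Simplex K (suc d) A × A ≢ η

    data Gallery : Subset v → Subset v → Set where
      stay : ∀ {A} → Avoiding A → Gallery A A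
      cross : ∀ {A B C} F → Avoiding A → Simplex K d F → F ⊆ A → F ⊆ B → Gallery B C → Gallery A C

    snoc : ∀ {A B C} → Gallery A B → ∀ F → Simplex K d F → F ⊆ B → F ⊆ C → Avoiding C → Gallery A C
    snoc (stay A-ok) F F-simplex F⊆B F⊆C C-ok = cross F A-ok F-simplex F⊆B F⊆C (stay C-ok)
    snoc (cross F' A-ok F'-simplex F'⊆A F'⊆B G) F F-simplex F⊆B F⊆C C-ok =
      cross F' A-ok F'-simplex F'⊆A F'⊆B (snoc G F F-simplex F⊆B F⊆C C-ok)

    reverse-gallery : ∀ {A B} → Gallery A B → Gallery B A
    reverse-gallery (stay A-ok) = stay A-ok
    reverse-gallery (cross F A-ok F-simplex F⊆A F⊆B G) = snoc (reverse-gallery G) F F-simplex F⊆B F⊆A A-ok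

    _++ᵍ_ : ∀ {A B C} → Gallery A B → Gallery B C → Gallery A C
    stay _ ++ᵍ G' = G'
    cross F A-ok F-simplex F⊆A F⊆B G ++ᵍ G' = cross F A-ok F-simplex F⊆A F⊆B (G ++ᵍ G')

    record Chain (A B : Subset v) : Set where
      field
        k : ℕ
        ρ F : ℕ → Subset v
        ρ₀≡A : ρ 0 ≡ A
        ρₖ≡B : ρ k ≡ B
        avoiding : ∀ j → j ≤ k → Avoiding (ρ j)
        F-simplex : ∀ j → j < k → Simplex K d (F j)
        F⊆ρ : ∀ j → j < k → F j ⊆ ρ j
        F⊆ρ-suc : ∀ j → j < k → F j ⊆ ρ (suc j)

    chain : ∀ {A B} → Gallery A B → Chain A B
    chain {A} (stay A-ok) = record
      { k = 0 ; ρ = λ _ → A ; F = λ _ → A ; ρ₀≡A = refl ; ρₖ≡B = refl ; avoiding = λ _ _ → A-ok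
      ; F-simplex = λ _ () ; F⊆ρ = λ _ () ; F⊆ρ-suc = λ _ () }
    chain {A} (cross F A-ok F-simplex F⊆A F⊆B G) = record
      { k = suc k ; ρ = A ◂ ρ ; F = F ◂ Fs ; ρ₀≡A = refl ; ρₖ≡B = ρₖ≡B
      ; avoiding = λ { zero _ → A-ok ; (suc j) j<k → avoiding j (s≤s⁻¹ j<k) }
      ; F-simplex = λ { zero _ → F-simplex ; (suc j) j<k → F-simplex′ j (s≤s⁻¹ j<k) }
      ; F⊆ρ = λ { zero _ → F⊆A ; (suc j) j<k → F⊆ρ j (s≤s⁻¹ j<k) }
      ; F⊆ρ-suc = λ { zero _ → subst (F ⊆_) (sym ρ₀≡A) F⊆B ; (suc j) j<k → F⊆ρ-suc j (s≤s⁻¹ j<k) } }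
      where open Chain (chain G) renaming (F to Fs; F-simplex to F-simplex′)

    gallery⇒loop : ∀ {A B W x} → Simplex K (suc d) η → Simplex K d W → W ⊆ η → x ∈ η → x ∉ W →
                   W ⊆ A → x ∈ B → Gallery A B → ∃ (Loop K d)
    gallery⇒loop {W = W} {x} η-simplex W-simplex W⊆η x∈η x∉W W⊆A x∈B G = suc k , record
      { ρ = η ◂ ρ ; F = W ◂ F ; x = x ; 1≤k = s≤s z≤n
      ; ρ-simplex = λ { zero _ → η-simplex ; (suc j) j<k → proj₁ (avoiding j (s≤s⁻¹ j<k)) }
      ; ρ≢ρ₀ = λ { (suc j) _ j<k → proj₂ (avoiding j (s≤s⁻¹ j<k)) }
      ; F-simplex = λ { zero _ → W-simplex ; (suc j) j<k → F-simplex j (s≤s⁻¹ j<k) }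
      ; F⊆ρ = λ { zero _ → W⊆η ; (suc j) j<k → F⊆ρ j (s≤s⁻¹ j<k) }
      ; F⊆ρ-suc = λ { zero _ → subst (W ⊆_) (sym ρ₀≡A) W⊆A ; (suc j) j<k → F⊆ρ-suc j (s≤s⁻¹ j<k) }
      ; x∈ρ₀ = x∈η ; x∈ρₖ = subst (x ∈_) (sym ρₖ≡B) x∈B ; x∉F₀ = x∉W }
      where open Chain (chain G)

-- Path sequences

module _ {v : ℕ} (K : Complex v) (m n : ℕ) where

  edge-path : ∀ {σ σ'} η → Simplex K m σ → Simplex K m σ' → Simplex K n η →
              σ ⊆ η → σ' ⊆ η → σ ≢ σ' → PathSeq K m n σ σ'
  edge-path {σ} {σ'} η σ-simplex σ'-simplex η-simplex σ⊆η σ'⊆η σ≢σ' = record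
    { r = 1 ; σs = σs ; ηs = λ _ → η
    ; walk = record
      { σ-simp = λ { (suc zero) _ _ → σ-simplex ; (suc (suc zero)) _ _ → σ'-simplex
                   ; (suc (suc (suc _))) _ (s≤s (s≤s ())) }
      ; η-simp = λ _ _ _ → η-simplex
      ; step≢ = λ { (suc zero) _ _ → σ≢σ' ; (suc (suc _)) _ (s≤s ()) }
      ; left⊆ = λ { (suc zero) _ _ → σ⊆η ; (suc (suc _)) _ (s≤s ()) }
      ; right⊆ = λ { (suc zero) _ _ → σ'⊆η ; (suc (suc _)) _ (s≤s ()) } }
    ; start = refl ; end = refl
    ; σ-inj = injective-on-range σs 1 2 σ-inj<
    ; η-inj = λ { (suc zero) (suc zero) _ _ _ _ 1≢1 → ⊥-elim (1≢1 refl)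
                ; (suc (suc _)) _ _ (s≤s ()) _ _ _
                ; (suc zero) (suc (suc _)) _ _ _ (s≤s ()) _ } }
    where
    σs : ℕ → Subset v
    σs (suc (suc _)) = σ'
    σs _ = σ
    σ-inj< : ∀ p q → 1 ≤ p → p < q → q ≤ 2 → σs p ≢ σs q
    σ-inj< (suc zero) (suc (suc zero)) _ _ _ = σ≢σ'
    σ-inj< (suc zero) (suc zero) _ (s≤s ()) _
    σ-inj< (suc zero) (suc (suc (suc _))) _ _ (s≤s (s≤s ()))
    σ-inj< (suc (suc _)) (suc zero) _ (s≤s ()) _
    σ-inj< (suc (suc _)) (suc (suc zero)) _ (s≤s (s≤s ())) _
    σ-inj< (suc (suc _)) (suc (suc (suc _))) _ _ (s≤s (s≤s ()))

  -- Prepends to a sequence indexed from 1, as the sequences of PathSeq are.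
  _◃_ : Subset v → (ℕ → Subset v) → ℕ → Subset v
  (a ◃ f) (suc (suc j)) = f (suc j)
  (a ◃ f) _ = a

  prepend-path : ∀ {σ σ₂ σ'} η (P : PathSeq K m n σ₂ σ') → Simplex K m σ → Simplex K n η →
            σ ⊆ η → σ₂ ⊆ η → σ ≢ σ₂ →
            (∀ k → 1 ≤ k → k ≤ suc (PathSeq.r P) → σ ≢ PathSeq.σs P k) →
            (∀ k → 1 ≤ k → k ≤ PathSeq.r P → η ≢ PathSeq.ηs P k) →
            PathSeq K m n σ σ'
  prepend-path {σ} η P σ-simplex η-simplex σ⊆η σ₂⊆η σ≢σ₂ σ∉P η∉P = record
    { r = suc r ; σs = σ ◃ σs ; ηs = η ◃ ηs
    ; walk = record
      { σ-simp = λ { (suc zero) _ _ → σ-simplex ; (suc (suc k)) _ (s≤s k≤) → σ-simp (suc k) (s≤s z≤n) k≤ }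
      ; η-simp = λ { (suc zero) _ _ → η-simplex ; (suc (suc k)) _ (s≤s k≤) → η-simp (suc k) (s≤s z≤n) k≤ }
      ; step≢ = λ { (suc zero) _ _ → subst (σ ≢_) (sym start) σ≢σ₂
                  ; (suc (suc k)) _ (s≤s k≤) → step≢ (suc k) (s≤s z≤n) k≤ }
      ; left⊆ = λ { (suc zero) _ _ → σ⊆η ; (suc (suc k)) _ (s≤s k≤) → left⊆ (suc k) (s≤s z≤n) k≤ }
      ; right⊆ = λ { (suc zero) _ _ → subst (_⊆ η) (sym start) σ₂⊆η
                   ; (suc (suc k)) _ (s≤s k≤) → right⊆ (suc k) (s≤s z≤n) k≤ } }
    ; start = refl ; end = end
    ; σ-inj = λ p q → injective-on-range (σ ◃ σs) 1 (suc (suc r)) σ-inj< p q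
    ; η-inj = λ p q → injective-on-range (η ◃ ηs) 1 (suc r) η-inj< p q }
    where
    open PathSeq P
    open IsWalk walk
    σ-inj< : ∀ p q → 1 ≤ p → p < q → q ≤ suc (suc r) → (σ ◃ σs) p ≢ (σ ◃ σs) q
    σ-inj< (suc zero) (suc (suc q)) _ _ (s≤s q≤) = σ∉P (suc q) (s≤s z≤n) q≤
    σ-inj< (suc (suc p)) (suc (suc q)) _ (s≤s p<q) (s≤s q≤) =
      σ-inj (suc p) (suc q) (s≤s z≤n) (≤-trans (<⇒≤ p<q) q≤) (s≤s z≤n) q≤ (<⇒≢ p<q)
    σ-inj< (suc zero) (suc zero) _ (s≤s ()) _
    σ-inj< (suc (suc _)) (suc zero) _ (s≤s ()) _
    η-inj< : ∀ p q → 1 ≤ p → p < q → q ≤ suc r → (η ◃ ηs) p ≢ (η ◃ ηs) q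
    η-inj< (suc zero) (suc (suc q)) _ _ (s≤s q≤) = η∉P (suc q) (s≤s z≤n) q≤
    η-inj< (suc (suc p)) (suc (suc q)) _ (s≤s p<q) (s≤s q≤) =
      η-inj (suc p) (suc q) (s≤s z≤n) (≤-trans (<⇒≤ p<q) q≤) (s≤s z≤n) q≤ (<⇒≢ p<q)
    η-inj< (suc zero) (suc zero) _ (s≤s ()) _
    η-inj< (suc (suc _)) (suc zero) _ (s≤s ()) _

  path-length≥1 : ∀ {σ σ'} (P : PathSeq K m n σ σ') → σ ≢ σ' → 1 ≤ PathSeq.r P
  path-length≥1 P σ≢σ' with PathSeq.r P | PathSeq.start P | PathSeq.end P
  ... | zero | σ₁≡σ | σ₁≡σ' = ⊥-elim (σ≢σ' (trans (sym σ₁≡σ) σ₁≡σ'))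
  ... | suc _ | _ | _ = s≤s z≤n

  mirror : ∀ {k n} → 1 ≤ k → k ≤ n → 1 ≤ suc n ∸ k × suc n ∸ k ≤ n
  mirror {k} {n} 1≤k k≤n =
    subst (1 ≤_) (sym (+-∸-assoc 1 k≤n)) (s≤s z≤n) , ∸-monoʳ-≤ (suc n) 1≤k

  reverse-path : ∀ {σ σ'} → PathSeq K m n σ σ' → PathSeq K m n σ' σ
  reverse-path P = record
    { r = r ; σs = σs ∘ (suc (suc r) ∸_) ; ηs = ηs ∘ (suc r ∸_)
    ; walk = record
      { σ-simp = λ k 1≤k k≤ → σ-simp _ (proj₁ (mirror 1≤k k≤)) (proj₂ (mirror 1≤k k≤))
      ; η-simp = λ k 1≤k k≤r → η-simp _ (proj₁ (mirror 1≤k k≤r)) (proj₂ (mirror 1≤k k≤r))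
      ; step≢ = λ k 1≤k k≤r → step≢ _ (proj₁ (mirror 1≤k k≤r)) (proj₂ (mirror 1≤k k≤r))
                  ∘ sym ∘ trans (σ-mirror k k≤r)
      ; left⊆ = λ k 1≤k k≤r → subst (_⊆ _) (σ-mirror k k≤r)
                  (right⊆ _ (proj₁ (mirror 1≤k k≤r)) (proj₂ (mirror 1≤k k≤r)))
      ; right⊆ = λ k 1≤k k≤r → left⊆ _ (proj₁ (mirror 1≤k k≤r)) (proj₂ (mirror 1≤k k≤r)) }
    ; start = end
    ; end = trans (cong σs (m+n∸n≡m 1 r)) start
    ; σ-inj = λ p q 1≤p p≤ 1≤q q≤ p≢q → σ-inj _ _
        (proj₁ (mirror 1≤p p≤)) (proj₂ (mirror 1≤p p≤))
        (proj₁ (mirror 1≤q q≤)) (proj₂ (mirror 1≤q q≤))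
        (p≢q ∘ ∸-cancelˡ-≡ (m≤n⇒m≤1+n p≤) (m≤n⇒m≤1+n q≤))
    ; η-inj = λ p q 1≤p p≤r 1≤q q≤r p≢q → η-inj _ _
        (proj₁ (mirror 1≤p p≤r)) (proj₂ (mirror 1≤p p≤r))
        (proj₁ (mirror 1≤q q≤r)) (proj₂ (mirror 1≤q q≤r))
        (p≢q ∘ ∸-cancelˡ-≡ (m≤n⇒m≤1+n p≤r) (m≤n⇒m≤1+n q≤r)) }
    where
    open PathSeq P
    open IsWalk walk
    σ-mirror : ∀ k → k ≤ r → σs (suc (suc r ∸ k)) ≡ σs (suc (suc r) ∸ k)
    σ-mirror k k≤r = cong σs (sym (+-∸-assoc 1 (m≤n⇒m≤1+n k≤r)))

-- A complete ordering makes K a simplicial tree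

module _ {v : ℕ} (ord : ℕ → Subset v) where

  OneOfFirst : ℕ → Subset v → Set
  OneOfFirst i τ = ∃ λ j → 1 ≤ j × j ≤ i × ord j ≡ τ

  FaceOfFirst : ℕ → Subset v → Set
  FaceOfFirst i σ = ∃ λ j → 1 ≤ j × j ≤ i × σ ⊆ ord j

  OneOfFirst-suc : ∀ {i τ} → OneOfFirst i τ → OneOfFirst (suc i) τ
  OneOfFirst-suc (j , 1≤j , j≤i , ordⱼ≡τ) = j , 1≤j , m≤n⇒m≤1+n j≤i , ordⱼ≡τ

module _ {v : ℕ} (K : Complex v) (d : ℕ) (O : CompleteOrdering K (suc d)) where
  open CompleteOrdering O renaming (ηs to ord)

  ord-simplex : ∀ j → 1 ≤ j → j ≤ t → ∣ ord j ∣ ≡ suc (suc d)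
  ord-simplex j 1≤j j≤t = proj₂ (simp j 1≤j j≤t)

  module Attachment (i : ℕ) (2≤i : 2 ≤ i) (i≤t : i ≤ t) where
    W : Subset v
    W = proj₁ (complete i 2≤i i≤t)

    ∣W∣ : ∣ W ∣ ≡ suc d
    ∣W∣ = proj₁ (proj₂ (complete i 2≤i i≤t))

    attachment⇔ : ∀ σ → InAttachment K (suc d) ord i σ ⇔ (Nonempty σ × σ ⊆ W)
    attachment⇔ = proj₂ (proj₂ (complete i 2≤i i≤t))

    shared⊆W : ∀ j τ → 1 ≤ j → j < i → Nonempty τ → τ ⊆ ord i → τ ⊆ ord j → τ ⊆ W
    shared⊆W j τ 1≤j j<i τ≢∅ τ⊆ordᵢ τ⊆ordⱼ = proj₂ (Equivalence.to (attachment⇔ τ)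
      (τ≢∅ , τ⊆ordᵢ , ord j ,
       ((∣p∣≡1+k⇒Nonempty ∣ordⱼ∣ , j , 1≤j , <⇒≤ j<i , ⊆-refl) , ∣ordⱼ∣) ,
       inj j i 1≤j j≤t (≤-trans (s≤s z≤n) 2≤i) i≤t (<⇒≢ j<i) , τ⊆ordⱼ))
      where
      j≤t = ≤-trans (<⇒≤ j<i) i≤t
      ∣ordⱼ∣ = ord-simplex j 1≤j j≤t

    W∈attachment : InAttachment K (suc d) ord i W
    W∈attachment = Equivalence.from (attachment⇔ W) (∣p∣≡1+k⇒Nonempty ∣W∣ , ⊆-refl)

    W⊆ordᵢ : W ⊆ ord i
    W⊆ordᵢ = proj₁ (proj₂ W∈attachment)

    W⊆earlier : ∃ λ j → 1 ≤ j × j < i × W ⊆ ord j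
    W⊆earlier with W∈attachment
    ... | _ , _ , ρ , ((_ , j , 1≤j , j≤i , ρ⊆ordⱼ) , ∣ρ∣) , ρ≢ordᵢ , W⊆ρ
      with refl ← ⊆-same-size⇒≡ ∣ρ∣ (ord-simplex j 1≤j (≤-trans j≤i i≤t)) ρ⊆ordⱼ
      with m≤n⇒m<n∨m≡n j≤i
    ... | inj₁ j<i = j , 1≤j , j<i , W⊆ρ
    ... | inj₂ refl = ⊥-elim (ρ≢ordᵢ refl)

  position : Subset v → ℕ
  position η with between? (λ j → ord j ≟ˢ η) 1 t
  ... | yes (j , _) = j
  ... | no _ = 0

  position-spec : ∀ η → Simplex K (suc d) η → 1 ≤ position η × position η ≤ t × ord (position η) ≡ η
  position-spec η η-simplex with between? (λ j → ord j ≟ˢ η) 1 t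
  ... | yes (_ , spec) = spec
  ... | no ¬found = ⊥-elim (¬found (surj η η-simplex))

  module LastInOrdering {m : ℕ} (C : CycleSeq K m (suc d)) where
    open CycleSeq C
    open IsWalk walk

    2≤r : 2 ≤ r
    2≤r = ≤-trans (n≤1+n 2) r≥3

    1≤r : 1 ≤ r
    1≤r = ≤-trans (n≤1+n 1) 2≤r

    2≤r∸1 : 2 ≤ r ∸ 1
    2≤r∸1 = m+n≤o⇒m≤o∸n 2 r≥3

    pos : ℕ → ℕ
    pos k = position (ηs k)

    pos-spec : ∀ k → 1 ≤ k → k ≤ r → 1 ≤ pos k × pos k ≤ t × ord (pos k) ≡ ηs k
    pos-spec k 1≤k k≤r = position-spec (ηs k) (η-simp k 1≤k k≤r)

    last = argmax pos r 1≤r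
    k₀ = proj₁ last
    1≤k₀ = proj₁ (proj₂ last)
    k₀≤r = proj₁ (proj₂ (proj₂ last))

    pos<pos-k₀ : ∀ k → 1 ≤ k → k ≤ r → k ≢ k₀ → pos k < pos k₀
    pos<pos-k₀ k 1≤k k≤r k≢k₀ = ≤∧≢⇒< (proj₂ (proj₂ (proj₂ last)) k 1≤k k≤r) λ posₖ≡pos-k₀ →
      η-inj k k₀ 1≤k k≤r 1≤k₀ k₀≤r k≢k₀ (trans (sym (proj₂ (proj₂ (pos-spec k 1≤k k≤r))))
        (trans (cong ord posₖ≡pos-k₀) (proj₂ (proj₂ (pos-spec k₀ 1≤k₀ k₀≤r)))))

    2≤pos-k₀ : 2 ≤ pos k₀
    2≤pos-k₀ with k₀ ≟ 1
    ... | yes k₀≡1 = ≤-trans (s≤s (proj₁ (pos-spec 2 (s≤s z≤n) 2≤r)))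
                       (pos<pos-k₀ 2 (s≤s z≤n) 2≤r λ 2≡k₀ → 1+n≢n (trans 2≡k₀ k₀≡1))
    ... | no k₀≢1 = ≤-trans (s≤s (proj₁ (pos-spec 1 ≤-refl 1≤r))) (pos<pos-k₀ 1 ≤-refl 1≤r (k₀≢1 ∘ sym))

    open Attachment (pos k₀) 2≤pos-k₀ (proj₁ (proj₂ (pos-spec k₀ 1≤k₀ k₀≤r)))

    ord-pos-k₀ : ord (pos k₀) ≡ ηs k₀
    ord-pos-k₀ = proj₂ (proj₂ (pos-spec k₀ 1≤k₀ k₀≤r))

    shared-with-k₀⊆W : ∀ k τ → 1 ≤ k → k ≤ r → k ≢ k₀ → Nonempty τ → τ ⊆ ηs k₀ → τ ⊆ ηs k → τ ⊆ W
    shared-with-k₀⊆W k τ 1≤k k≤r k≢k₀ τ≢∅ τ⊆ηₖ₀ τ⊆ηₖ =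
      shared⊆W (pos k) τ (proj₁ spec) (pos<pos-k₀ k 1≤k k≤r k≢k₀) τ≢∅
        (subst (τ ⊆_) (sym ord-pos-k₀) τ⊆ηₖ₀) (subst (τ ⊆_) (sym (proj₂ (proj₂ spec))) τ⊆ηₖ)
      where spec = pos-spec k 1≤k k≤r

    σ'≡W : ∀ z k → 2 ≤ z → z ≤ r → 1 ≤ k → k ≤ r → k ≢ k₀ → σ's z ⊆ ηs k₀ → σ's z ⊆ ηs k → σ's z ≡ W
    σ'≡W z k 2≤z z≤r 1≤k k≤r k≢k₀ σ'⊆ηₖ₀ σ'⊆ηₖ =
      ⊆-same-size⇒≡ ∣σ'∣ ∣W∣ (shared-with-k₀⊆W k (σ's z) 1≤k k≤r k≢k₀ (∣p∣≡1+k⇒Nonempty ∣σ'∣) σ'⊆ηₖ₀ σ'⊆ηₖ)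
      where ∣σ'∣ = proj₂ (σ'-simp z 2≤z z≤r)

    σ₁≢∅ : Nonempty (σs 1)
    σ₁≢∅ = ∣p∣≡1+k⇒Nonempty (proj₂ (σ-simp 1 ≤-refl (m≤n⇒m≤1+n 1≤r)))

    σ₁⊆η₁ : σs 1 ⊆ ηs 1
    σ₁⊆η₁ = left⊆ 1 ≤-refl 1≤r

    σ₁⊆ηᵣ : σs 1 ⊆ ηs r
    σ₁⊆ηᵣ = subst (_⊆ ηs r) closed (right⊆ r 1≤r ≤-refl)

    σ₁⊆W : k₀ ≡ 1 ⊎ k₀ ≡ r → σs 1 ⊆ W
    σ₁⊆W (inj₁ k₀≡1) = shared-with-k₀⊆W r (σs 1) 1≤r ≤-refl (λ r≡k₀ → <⇒≢ 2≤r (sym (trans r≡k₀ k₀≡1)))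
      σ₁≢∅ (subst (λ k → σs 1 ⊆ ηs k) (sym k₀≡1) σ₁⊆η₁) σ₁⊆ηᵣ
    σ₁⊆W (inj₂ k₀≡r) = shared-with-k₀⊆W 1 (σs 1) ≤-refl 1≤r (λ 1≡k₀ → <⇒≢ 2≤r (trans 1≡k₀ k₀≡r))
      σ₁≢∅ (subst (λ k → σs 1 ⊆ ηs k) (sym k₀≡r) σ₁⊆ηᵣ) σ₁⊆η₁

    cycle-impossible : ⊥
    cycle-impossible with k₀ ≟ 1 | k₀ ≟ r
    ... | yes k₀≡1 | _ = notFace 2 ≤-refl 2≤r∸1 (⊆-trans (σ₁⊆W (inj₁ k₀≡1))
          (subst (_⊆ ηs 2) σ'₂≡W (σ'-right 2 ≤-refl 2≤r)))
      where
      σ'₂≡W = σ'≡W 2 2 ≤-refl 2≤r (s≤s z≤n) 2≤r (λ 2≡k₀ → 1+n≢n (trans 2≡k₀ k₀≡1))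
                (subst (λ k → σ's 2 ⊆ ηs k) (sym k₀≡1) (σ'-left 2 ≤-refl 2≤r)) (σ'-right 2 ≤-refl 2≤r)
    ... | no _ | yes k₀≡r = notFace (r ∸ 1) 2≤r∸1 ≤-refl (⊆-trans (σ₁⊆W (inj₂ k₀≡r))
          (subst (_⊆ ηs (r ∸ 1)) σ'ᵣ≡W (σ'-left r 2≤r ≤-refl)))
      where
      σ'ᵣ≡W = σ'≡W r (r ∸ 1) 2≤r ≤-refl (≤-trans (s≤s z≤n) 2≤r∸1) (m∸n≤m r 1)
                (λ r∸1≡k₀ → <⇒≢ (∸-monoʳ-< (s≤s z≤n) 1≤r) (trans r∸1≡k₀ k₀≡r))
                (subst (λ k → σ's r ⊆ ηs k) (sym k₀≡r) (σ'-right r 2≤r ≤-refl)) (σ'-left r 2≤r ≤-refl)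
    ... | no k₀≢1 | no k₀≢r = σ'-inj k₀ (suc k₀) 2≤k₀ (<⇒≤ k₀<r) (m≤n⇒m≤1+n 2≤k₀) k₀<r (<⇒≢ (n<1+n k₀))
          (trans σ'ₖ₀≡W (sym σ'ₖ₀₊₁≡W))
      where
      2≤k₀ = ≤∧≢⇒< 1≤k₀ (k₀≢1 ∘ sym)
      k₀<r = ≤∧≢⇒< k₀≤r k₀≢r
      σ'ₖ₀≡W = σ'≡W k₀ (k₀ ∸ 1) 2≤k₀ k₀≤r (m+n≤o⇒m≤o∸n 1 2≤k₀) (≤-trans (m∸n≤m k₀ 1) k₀≤r)
                 (<⇒≢ (∸-monoʳ-< (s≤s z≤n) 1≤k₀)) (σ'-right k₀ 2≤k₀ k₀≤r) (σ'-left k₀ 2≤k₀ k₀≤r)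
      σ'ₖ₀₊₁≡W = σ'≡W (suc k₀) (suc k₀) (m≤n⇒m≤1+n 2≤k₀) k₀<r (s≤s z≤n) k₀<r (1+n≢n)
                   (σ'-left (suc k₀) (m≤n⇒m≤1+n 2≤k₀) k₀<r) (σ'-right (suc k₀) (m≤n⇒m≤1+n 2≤k₀) k₀<r)

  ordering⇒acyclic : Acyclic K (suc d)
  ordering⇒acyclic _ _ = LastInOrdering.cycle-impossible

  record PathWithin (i : ℕ) (σ σ' : Subset v) : Set where
    field
      path : PathSeq K d (suc d) σ σ'
      within : ∀ k → 1 ≤ k → k ≤ PathSeq.r path → OneOfFirst ord i (PathSeq.ηs path k)

    σs-within : σ ≢ σ' → ∀ k → 1 ≤ k → k ≤ suc (PathSeq.r path) → FaceOfFirst ord i (PathSeq.σs path k)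
    σs-within σ≢σ' k 1≤k k≤1+r with ≤1+n⇒≤n⊎≡1+n k≤1+r
    ... | inj₁ k≤r with j , 1≤j , j≤i , ordⱼ≡ηₖ ← within k 1≤k k≤r =
          j , 1≤j , j≤i , subst (_ ⊆_) (sym ordⱼ≡ηₖ) (IsWalk.left⊆ (PathSeq.walk path) k 1≤k k≤r)
    ... | inj₂ refl = last-within (path-length≥1 K d (suc d) path σ≢σ')
      where
      last-within : 1 ≤ PathSeq.r path → FaceOfFirst ord i (PathSeq.σs path (suc (PathSeq.r path)))
      last-within 1≤r with j , 1≤j , j≤i , ordⱼ≡ηᵣ ← within _ 1≤r ≤-refl =
        j , 1≤j , j≤i , subst (_ ⊆_) (sym ordⱼ≡ηᵣ) (IsWalk.right⊆ (PathSeq.walk path) _ 1≤r ≤-refl)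

  ConnectedWithin : ℕ → Set
  ConnectedWithin i = ∀ σ σ' → Simplex K d σ → Simplex K d σ' → σ ≢ σ' →
    FaceOfFirst ord i σ → FaceOfFirst ord i σ' → PathWithin i σ σ'

  PathWithin-suc : ∀ {i σ σ'} → PathWithin i σ σ' → PathWithin (suc i) σ σ'
  PathWithin-suc P = record { path = path ; within = λ k 1≤k k≤r → OneOfFirst-suc ord (within k 1≤k k≤r) }
    where open PathWithin P

  PathWithin-reverse : ∀ {i σ σ'} → PathWithin i σ σ' → PathWithin i σ' σ
  PathWithin-reverse P = record
    { path = reverse-path K d (suc d) path
    ; within = λ k 1≤k k≤r → within _ (proj₁ (mirror K d (suc d) 1≤k k≤r)) (proj₂ (mirror K d (suc d) 1≤k k≤r)) }
    where open PathWithin P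

  edge-within : ∀ {i σ σ'} j → 1 ≤ j → j ≤ i → j ≤ t → Simplex K d σ → Simplex K d σ' →
                σ ⊆ ord j → σ' ⊆ ord j → σ ≢ σ' → PathWithin i σ σ'
  edge-within j 1≤j j≤i j≤t σ-simplex σ'-simplex σ⊆ordⱼ σ'⊆ordⱼ σ≢σ' = record
    { path = edge-path K d (suc d) (ord j) σ-simplex σ'-simplex (simp j 1≤j j≤t) σ⊆ordⱼ σ'⊆ordⱼ σ≢σ'
    ; within = λ _ _ _ → j , 1≤j , j≤i , refl }

  connected-within-1 : 1 ≤ t → ConnectedWithin 1
  connected-within-1 1≤t σ σ' σ-simplex σ'-simplex σ≢σ'
    (j , 1≤j , j≤1 , σ⊆ordⱼ) (j' , 1≤j' , j'≤1 , σ'⊆ordⱼ')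
    with refl ← ≤-antisym j≤1 1≤j | refl ← ≤-antisym j'≤1 1≤j' =
    edge-within 1 ≤-refl ≤-refl 1≤t σ-simplex σ'-simplex σ⊆ordⱼ σ'⊆ordⱼ' σ≢σ'

  module Extend (isC : IsComplex K) (i : ℕ) (1≤i : 1 ≤ i) (1+i≤t : suc i ≤ t)
                (IH : ConnectedWithin i) where
    η = ord (suc i)
    η-simplex = simp (suc i) (s≤s z≤n) 1+i≤t
    open Attachment (suc i) (s≤s 1≤i) 1+i≤t

    W-simplex : Simplex K d W
    W-simplex = IsComplex.faceClosed isC η W (proj₁ η-simplex) (∣p∣≡1+k⇒Nonempty ∣W∣) W⊆ordᵢ , ∣W∣

    W-old : FaceOfFirst ord i W
    W-old with j , 1≤j , j<1+i , W⊆ordⱼ ← W⊆earlier = j , 1≤j , s≤s⁻¹ j<1+i , W⊆ordⱼ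

    new⊆η : ∀ σ → FaceOfFirst ord (suc i) σ → ¬ FaceOfFirst ord i σ → σ ⊆ η
    new⊆η σ (j , 1≤j , j≤1+i , σ⊆ordⱼ) σ-new with ≤1+n⇒≤n⊎≡1+n j≤1+i
    ... | inj₁ j≤i = ⊥-elim (σ-new (j , 1≤j , j≤i , σ⊆ordⱼ))
    ... | inj₂ refl = σ⊆ordⱼ

    new-to-old : ∀ σ σ' → Simplex K d σ → Simplex K d σ' → σ ≢ σ' →
                 ¬ FaceOfFirst ord i σ → σ ⊆ η → FaceOfFirst ord i σ' → PathWithin (suc i) σ σ'
    new-to-old σ σ' σ-simplex σ'-simplex σ≢σ' σ-new σ⊆η σ'-old with σ' ≟ˢ W
    ... | yes refl = edge-within (suc i) (s≤s z≤n) ≤-refl 1+i≤t σ-simplex W-simplex σ⊆η W⊆ordᵢ σ≢σ'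
    ... | no σ'≢W = record
      { path = prepend-path K d (suc d) η path σ-simplex η-simplex σ⊆η W⊆ordᵢ
                 σ≢W σ∉P η∉P
      ; within = λ { (suc zero) _ _ → suc i , s≤s z≤n , ≤-refl , refl
                   ; (suc (suc k)) _ (s≤s k≤r) → OneOfFirst-suc ord (within (suc k) (s≤s z≤n) k≤r) } }
      where
      P = IH W σ' W-simplex σ'-simplex (σ'≢W ∘ sym) W-old σ'-old
      open PathWithin P
      open PathSeq path
      σ≢W : σ ≢ W
      σ≢W σ≡W = σ-new (subst (FaceOfFirst ord i) (sym σ≡W) W-old)
      σ∉P : ∀ k → 1 ≤ k → k ≤ suc r → σ ≢ σs k
      σ∉P k 1≤k k≤1+r σ≡σₖ = σ-new (subst (FaceOfFirst ord i) (sym σ≡σₖ) (σs-within (σ'≢W ∘ sym) k 1≤k k≤1+r))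
      η∉P : ∀ k → 1 ≤ k → k ≤ r → η ≢ ηs k
      η∉P k 1≤k k≤r η≡ηₖ with j , 1≤j , j≤i , ordⱼ≡ηₖ ← within k 1≤k k≤r =
        inj (suc i) j (s≤s z≤n) 1+i≤t 1≤j (≤-trans (m≤n⇒m≤1+n j≤i) 1+i≤t) (<⇒≢ (s≤s j≤i) ∘ sym)
          (trans η≡ηₖ (sym ordⱼ≡ηₖ))

    connected-within : ConnectedWithin (suc i)
    connected-within σ σ' σ-simplex σ'-simplex σ≢σ' σ-in σ'-in
      with between? (λ j → σ ⊆? ord j) 1 i | between? (λ j → σ' ⊆? ord j) 1 i
    ... | yes σ-old | yes σ'-old = PathWithin-suc (IH σ σ' σ-simplex σ'-simplex σ≢σ' σ-old σ'-old)
    ... | no σ-new | yes σ'-old = new-to-old σ σ' σ-simplex σ'-simplex σ≢σ' σ-new (new⊆η σ σ-in σ-new) σ'-old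
    ... | yes σ-old | no σ'-new = PathWithin-reverse
          (new-to-old σ' σ σ'-simplex σ-simplex (σ≢σ' ∘ sym) σ'-new (new⊆η σ' σ'-in σ'-new) σ-old)
    ... | no σ-new | no σ'-new = edge-within (suc i) (s≤s z≤n) ≤-refl 1+i≤t σ-simplex σ'-simplex
          (new⊆η σ σ-in σ-new) (new⊆η σ' σ'-in σ'-new) σ≢σ'

  connected-within : IsComplex K → ∀ i → 1 ≤ i → i ≤ t → ConnectedWithin i
  connected-within isC (suc zero) _ 1≤t = connected-within-1 1≤t
  connected-within isC (suc (suc i)) _ 2+i≤t = Extend.connected-within isC (suc i) (s≤s z≤n) 2+i≤t
    (connected-within isC (suc i) (s≤s z≤n) (<⇒≤ 2+i≤t))

  facet-in-ordering : Pure K (suc d) → ∀ σ → Simplex K d σ → FaceOfFirst ord t σ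
  facet-in-ordering pure σ (σ∈K , _) with η , η-simplex , σ⊆η ← Pure.pure pure σ σ∈K
    with j , 1≤j , j≤t , ordⱼ≡η ← surj η η-simplex = j , 1≤j , j≤t , subst (σ ⊆_) (sym ordⱼ≡η) σ⊆η

  ordering⇒connected : IsComplex K → Pure K (suc d) → Connected K (suc d)
  ordering⇒connected isC pure σ σ' σ-simplex σ'-simplex σ≢σ' =
    PathWithin.path (connected-within isC t (≤-trans 1≤j j≤t) ≤-refl σ σ' σ-simplex σ'-simplex σ≢σ' σ-in σ'-in)
    where
    σ-in = facet-in-ordering pure σ σ-simplex
    σ'-in = facet-in-ordering pure σ' σ'-simplex
    1≤j = proj₁ (proj₂ σ-in)
    j≤t = proj₁ (proj₂ (proj₂ σ-in))

-- A simplicial tree has a complete ordering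

module _ {v : ℕ} (K : Complex v) (n : ℕ) where

  InAttachment-cong : ∀ {f g : ℕ → Subset v} {j σ} → (∀ s → s ≤ j → f s ≡ g s) →
                      InAttachment K n f j σ → InAttachment K n g j σ
  InAttachment-cong {f} {g} {j} {σ} f≡g (σ≢∅ , σ⊆fⱼ , ρ , ((ρ≢∅ , s , 1≤s , s≤j , ρ⊆fₛ) , ∣ρ∣) , ρ≢fⱼ , σ⊆ρ) =
    σ≢∅ , subst (σ ⊆_) (f≡g j ≤-refl) σ⊆fⱼ ,
    ρ , ((ρ≢∅ , s , 1≤s , s≤j , subst (ρ ⊆_) (f≡g s s≤j) ρ⊆fₛ) , ∣ρ∣) ,
    (λ ρ≡gⱼ → ρ≢fⱼ (trans ρ≡gⱼ (sym (f≡g j ≤-refl)))) , σ⊆ρ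

  complete-cong : ∀ {f g : ℕ → Subset v} {j} → (∀ s → s ≤ j → f s ≡ g s) →
                  IsCompleteOn K n (InAttachment K n f j) → IsCompleteOn K n (InAttachment K n g j)
  complete-cong f≡g (W , ∣W∣ , attachment⇔) = W , ∣W∣ , λ σ → mk⇔
    (Equivalence.to (attachment⇔ σ) ∘ InAttachment-cong (λ s s≤j → sym (f≡g s s≤j)))
    (InAttachment-cong f≡g ∘ Equivalence.from (attachment⇔ σ))

module _ {v : ℕ} (K : Complex v) (d : ℕ) (isC : IsComplex K) (T : SimplicialTree K (suc d)) where
  open SimplicialTree T using (connected; acyclic)

  -- The parents record the adjacencies used to build the ordering, so that any two
  -- chosen simplices are joined by a gallery of chosen simplices.
  record PartialOrdering (i : ℕ) : Set where
    field
      ord : ℕ → Subset v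
      1≤i : 1 ≤ i
      simp : ∀ j → 1 ≤ j → j ≤ i → Simplex K (suc d) (ord j)
      inj : ∀ p q → 1 ≤ p → p ≤ i → 1 ≤ q → q ≤ i → p ≢ q → ord p ≢ ord q
      parent : ∀ j → 2 ≤ j → j ≤ i →
        ∃ λ j' → 1 ≤ j' × j' < j × ∃ λ F → Simplex K d F × F ⊆ ord j × F ⊆ ord j'
      complete : ∀ j → 2 ≤ j → j ≤ i → IsCompleteOn K (suc d) (InAttachment K (suc d) ord j)

  facet-of : ∀ η → Simplex K (suc d) η → ∃ λ F → Simplex K d F × F ⊆ η
  facet-of η (η∈K , ∣η∣) with y , y∈η ← ∣p∣≡1+k⇒Nonempty ∣η∣ =
    η - y , (IsComplex.faceClosed isC η (η - y) η∈K (∣p∣≡1+k⇒Nonempty ∣η-y∣) (p─q⊆p η ⁅ y ⁆) , ∣η-y∣) ,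
    p─q⊆p η ⁅ y ⁆
    where ∣η-y∣ = suc-injective (trans (x∈p⇒∣p-x∣+1≡∣p∣ η y∈η) ∣η∣)

  module _ {i : ℕ} (S : PartialOrdering i) where
    open PartialOrdering S

    Chosen : Subset v → Set
    Chosen = OneOfFirst ord i

    chosen? : ∀ η → Dec (Chosen η)
    chosen? η = between? (λ j → ord j ≟ˢ η) 1 i

    Unchosen : Subset v → Set
    Unchosen η = Simplex K (suc d) η × ¬ Chosen η

    unchosen? : ∀ η → Dec (Unchosen η)
    unchosen? η = (T? (K η) ×-dec ∣ η ∣ ≟ suc (suc d)) ×-dec ¬? (chosen? η)

    module _ {η : Subset v} (η-unchosen : ¬ Chosen η) where

      ord-avoids : ∀ j → 1 ≤ j → j ≤ i → Avoiding K d η (ord j)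
      ord-avoids j 1≤j j≤i = simp j 1≤j j≤i , λ ordⱼ≡η → η-unchosen (j , 1≤j , j≤i , ordⱼ≡η)

      to-root : ∀ j → 1 ≤ j → j ≤ i → Acc _<_ j → Gallery K d η (ord j) (ord 1)
      to-root (suc zero) 1≤j j≤i _ = stay (ord-avoids 1 1≤j j≤i)
      to-root (suc (suc j)) 1≤j j≤i (acc earlier)
        with j' , 1≤j' , j'<j , F , F-simplex , F⊆ordⱼ , F⊆ordⱼ' ← parent (suc (suc j)) (s≤s (s≤s z≤n)) j≤i =
        cross F (ord-avoids (suc (suc j)) 1≤j j≤i) F-simplex F⊆ordⱼ F⊆ordⱼ'
          (to-root j' 1≤j' (≤-trans (<⇒≤ j'<j) j≤i) (earlier j'<j))

      gallery-between : ∀ p q → 1 ≤ p → p ≤ i → 1 ≤ q → q ≤ i → Gallery K d η (ord p) (ord q)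
      gallery-between p q 1≤p p≤i 1≤q q≤i = _++ᵍ_ K d η (to-root p 1≤p p≤i (<-wellFounded p))
        (reverse-gallery K d η (to-root q 1≤q q≤i (<-wellFounded q)))

    record Attachable : Set where
      field
        η : Subset v
        η-simplex : Simplex K (suc d) η
        η-unchosen : ¬ Chosen η
        j₀ : ℕ
        1≤j₀ : 1 ≤ j₀
        j₀≤i : j₀ ≤ i
        F : Subset v
        F-simplex : Simplex K d F
        F⊆ordⱼ₀ : F ⊆ ord j₀
        F⊆η : F ⊆ η

    module Append (A : Attachable) where
      open Attachable A

      extended : ∀ {s} → Dec (s ≤ i) → Subset v
      extended {s} (yes _) = ord s
      extended (no _) = η

      ord' : ℕ → Subset v
      ord' s = extended (s ≤? i)

      ord'-old : ∀ s → s ≤ i → ord' s ≡ ord s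
      ord'-old s s≤i with s ≤? i
      ... | yes _ = refl
      ... | no s≰i = ⊥-elim (s≰i s≤i)

      ord'-new : ord' (suc i) ≡ η
      ord'-new with suc i ≤? i
      ... | yes 1+i≤i = ⊥-elim (<-irrefl refl 1+i≤i)
      ... | no _ = refl

      ord'-split : ∀ s → s ≤ suc i → (s ≤ i × ord' s ≡ ord s) ⊎ (s ≡ suc i × ord' s ≡ η)
      ord'-split s s≤1+i with ≤1+n⇒≤n⊎≡1+n s≤1+i
      ... | inj₁ s≤i = inj₁ (s≤i , ord'-old s s≤i)
      ... | inj₂ refl = inj₂ (refl , ord'-new)

      simp' : ∀ s → 1 ≤ s → s ≤ suc i → Simplex K (suc d) (ord' s)
      simp' s 1≤s s≤1+i with ord'-split s s≤1+i
      ... | inj₁ (s≤i , ord'ₛ≡ordₛ) = subst (Simplex K (suc d)) (sym ord'ₛ≡ordₛ) (simp s 1≤s s≤i)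
      ... | inj₂ (_ , ord'ₛ≡η) = subst (Simplex K (suc d)) (sym ord'ₛ≡η) η-simplex

      inj' : ∀ p q → 1 ≤ p → p ≤ suc i → 1 ≤ q → q ≤ suc i → p ≢ q → ord' p ≢ ord' q
      inj' p q 1≤p p≤1+i 1≤q q≤1+i p≢q with ord'-split p p≤1+i | ord'-split q q≤1+i
      ... | inj₁ (p≤i , ord'p≡ordp) | inj₁ (q≤i , ord'q≡ordq) = λ ord'p≡ord'q →
            inj p q 1≤p p≤i 1≤q q≤i p≢q (trans (sym ord'p≡ordp) (trans ord'p≡ord'q ord'q≡ordq))
      ... | inj₁ (p≤i , ord'p≡ordp) | inj₂ (_ , ord'q≡η) = λ ord'p≡ord'q →
            η-unchosen (p , 1≤p , p≤i , trans (sym ord'p≡ordp) (trans ord'p≡ord'q ord'q≡η))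
      ... | inj₂ (_ , ord'p≡η) | inj₁ (q≤i , ord'q≡ordq) = λ ord'p≡ord'q →
            η-unchosen (q , 1≤q , q≤i , trans (sym ord'q≡ordq) (trans (sym ord'p≡ord'q) ord'p≡η))
      ... | inj₂ (refl , _) | inj₂ (refl , _) = ⊥-elim (p≢q refl)

      parent' : ∀ s → 2 ≤ s → s ≤ suc i →
        ∃ λ j' → 1 ≤ j' × j' < s × ∃ λ F → Simplex K d F × F ⊆ ord' s × F ⊆ ord' j'
      parent' s 2≤s s≤1+i with ord'-split s s≤1+i
      ... | inj₁ (s≤i , ord'ₛ≡ordₛ)
        with j' , 1≤j' , j'<s , F' , F'-simplex , F'⊆ordₛ , F'⊆ordⱼ' ← parent s 2≤s s≤i =
            j' , 1≤j' , j'<s , F' , F'-simplex , subst (F' ⊆_) (sym ord'ₛ≡ordₛ) F'⊆ordₛ ,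
            subst (F' ⊆_) (sym (ord'-old j' (≤-trans (<⇒≤ j'<s) s≤i))) F'⊆ordⱼ'
      ... | inj₂ (refl , ord'ₛ≡η) =
            j₀ , 1≤j₀ , s≤s j₀≤i , F , F-simplex , subst (F ⊆_) (sym ord'ₛ≡η) F⊆η ,
            subst (F ⊆_) (sym (ord'-old j₀ j₀≤i)) F⊆ordⱼ₀

      attached-to-F : ∀ σ → InAttachment K (suc d) ord' (suc i) σ → σ ⊆ F
      attached-to-F σ (_ , σ⊆ord'₁₊ᵢ , ρ , ((_ , j , 1≤j , j≤1+i , ρ⊆ord'ⱼ) , ∣ρ∣) , ρ≢ord'₁₊ᵢ , σ⊆ρ)
        with σ ⊆? F
      ... | yes σ⊆F = σ⊆F
      ... | no σ⊈F with y , y∈σ , y∉F ← p⊈q⇒∃∈∉ σ⊈F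
        with refl ← ⊆-same-size⇒≡ ∣ρ∣ (proj₂ (simp' j 1≤j j≤1+i)) ρ⊆ord'ⱼ
        with ord'-split j j≤1+i
      ... | inj₂ (refl , _) = ⊥-elim (ρ≢ord'₁₊ᵢ refl)
      ... | inj₁ (j≤i , ord'ⱼ≡ordⱼ) = ⊥-elim (acyclic 0 (s≤s z≤n) (loop⇒cycle K d isC (proj₂ loop)))
        where
        loop = gallery⇒loop K d η η-simplex F-simplex F⊆η (subst (y ∈_) ord'-new (σ⊆ord'₁₊ᵢ y∈σ)) y∉F
                 F⊆ordⱼ₀ (subst (y ∈_) ord'ⱼ≡ordⱼ (σ⊆ρ y∈σ))
                 (gallery-between η-unchosen j₀ j 1≤j₀ j₀≤i 1≤j j≤i)

      F-face-attached : ∀ σ → Nonempty σ × σ ⊆ F → InAttachment K (suc d) ord' (suc i) σ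
      F-face-attached σ (σ≢∅ , σ⊆F) =
        σ≢∅ , subst (σ ⊆_) (sym ord'-new) (⊆-trans σ⊆F F⊆η) ,
        ord j₀ ,
        ((∣p∣≡1+k⇒Nonempty ∣ordⱼ₀∣ , j₀ , 1≤j₀ , m≤n⇒m≤1+n j₀≤i , ⊆-reflexive (sym (ord'-old j₀ j₀≤i))) , ∣ordⱼ₀∣) ,
        (λ ordⱼ₀≡ord'₁₊ᵢ → η-unchosen (j₀ , 1≤j₀ , j₀≤i , trans ordⱼ₀≡ord'₁₊ᵢ ord'-new)) ,
        ⊆-trans σ⊆F F⊆ordⱼ₀
        where ∣ordⱼ₀∣ = proj₂ (simp j₀ 1≤j₀ j₀≤i)

      complete-new : IsCompleteOn K (suc d) (InAttachment K (suc d) ord' (suc i))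
      complete-new = F , proj₂ F-simplex , λ σ → mk⇔
        (λ σ-attached → proj₁ σ-attached , λ {y} → attached-to-F σ σ-attached {y})
        (F-face-attached σ)

      complete' : ∀ s → 2 ≤ s → s ≤ suc i → IsCompleteOn K (suc d) (InAttachment K (suc d) ord' s)
      complete' s 2≤s s≤1+i with ≤1+n⇒≤n⊎≡1+n s≤1+i
      ... | inj₁ s≤i =
            complete-cong K (suc d) (λ s' s'≤s → sym (ord'-old s' (≤-trans s'≤s s≤i))) (complete s 2≤s s≤i)
      ... | inj₂ refl = complete-new

      appended : PartialOrdering (suc i)
      appended = record
        { ord = ord' ; 1≤i = s≤s z≤n ; simp = simp' ; inj = inj' ; parent = parent' ; complete = complete' }

    module _ {σ σ' : Subset v} (P : PathSeq K d (suc d) σ σ') where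
      open PathSeq P
      open IsWalk walk

      along-path : FaceOfFirst ord i σ → ∀ k → 1 ≤ k → k ≤ suc r → Attachable ⊎ FaceOfFirst ord i (σs k)
      along-path (j , 1≤j , j≤i , σ⊆ordⱼ) (suc zero) _ _ =
        inj₂ (j , 1≤j , j≤i , subst (_⊆ ord j) (sym start) σ⊆ordⱼ)
      along-path σ-chosen (suc (suc k)) _ 2+k≤1+r
        with along-path σ-chosen (suc k) (s≤s z≤n) (m≤n⇒m≤1+n (s≤s⁻¹ 2+k≤1+r))
      ... | inj₁ A = inj₁ A
      ... | inj₂ (j , 1≤j , j≤i , σₖ⊆ordⱼ) with chosen? (ηs (suc k))
      ...   | yes (j' , 1≤j' , j'≤i , ordⱼ'≡ηₖ) =
              inj₂ (j' , 1≤j' , j'≤i , subst (_ ⊆_) (sym ordⱼ'≡ηₖ) (right⊆ (suc k) (s≤s z≤n) (s≤s⁻¹ 2+k≤1+r)))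
      ...   | no ηₖ-unchosen = inj₁ record
              { η = ηs (suc k) ; η-simplex = η-simp (suc k) (s≤s z≤n) (s≤s⁻¹ 2+k≤1+r) ; η-unchosen = ηₖ-unchosen
              ; j₀ = j ; 1≤j₀ = 1≤j ; j₀≤i = j≤i
              ; F = σs (suc k) ; F-simplex = σ-simp (suc k) (s≤s z≤n) (m≤n⇒m≤1+n (s≤s⁻¹ 2+k≤1+r))
              ; F⊆ordⱼ₀ = σₖ⊆ordⱼ ; F⊆η = left⊆ (suc k) (s≤s z≤n) (s≤s⁻¹ 2+k≤1+r) }

    -- The first unchosen simplex along a path from a facet of ord 1 to a facet
    -- of an unchosen η₀ is attached to a chosen one.
    attachable : ∀ η₀ → Unchosen η₀ → Attachable
    attachable η₀ (η₀-simplex , η₀-unchosen) = attach-at (σ ≟ˢ σ')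
      where
      σ-facet = facet-of (ord 1) (simp 1 ≤-refl 1≤i)
      σ'-facet = facet-of η₀ η₀-simplex
      σ = proj₁ σ-facet
      σ' = proj₁ σ'-facet
      σ'⊆η₀ = proj₂ (proj₂ σ'-facet)
      via-σ' : FaceOfFirst ord i σ' → Attachable
      via-σ' (j , 1≤j , j≤i , σ'⊆ordⱼ) = record
        { η = η₀ ; η-simplex = η₀-simplex ; η-unchosen = η₀-unchosen ; j₀ = j ; 1≤j₀ = 1≤j ; j₀≤i = j≤i
        ; F = σ' ; F-simplex = proj₁ (proj₂ σ'-facet) ; F⊆ordⱼ₀ = σ'⊆ordⱼ ; F⊆η = σ'⊆η₀ }
      σ-chosen : FaceOfFirst ord i σ
      σ-chosen = 1 , ≤-refl , 1≤i , proj₂ (proj₂ σ-facet)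
      attach-at : Dec (σ ≡ σ') → Attachable
      attach-at (yes σ≡σ') = via-σ' (subst (FaceOfFirst ord i) σ≡σ' σ-chosen)
      attach-at (no σ≢σ') =
        [ id , via-σ' ∘ subst (FaceOfFirst ord i) (PathSeq.end P) ]′
          (along-path P σ-chosen (suc (PathSeq.r P)) (s≤s z≤n) ≤-refl)
        where P = connected σ σ' (proj₁ (proj₂ σ-facet)) (proj₁ (proj₂ σ'-facet)) σ≢σ'

  #unchosen : ∀ {i} → PartialOrdering i → ℕ
  #unchosen S = List.length (List.filter (unchosen? S) (allSubsets v))

  appending-chooses : ∀ {i} (S : PartialOrdering i) (A : Attachable S) →
                      #unchosen (Append.appended S A) < #unchosen S
  appending-chooses {i} S A = length-filter-mono-< (unchosen? S) (unchosen? S') still-unchosen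
    (allSubsets v) (∈-allSubsets η) (η-simplex , η-unchosen)
    λ (_ , η-unchosen') → η-unchosen' (suc i , s≤s z≤n , ≤-refl , ord'-new)
    where
    open Attachable A
    open Append S A
    S' = appended
    still-unchosen : ∀ τ → Unchosen S' τ → Unchosen S τ
    still-unchosen τ (τ-simplex , τ-unchosen') = τ-simplex , λ (j , 1≤j , j≤i , ordⱼ≡τ) →
      τ-unchosen' (j , 1≤j , m≤n⇒m≤1+n j≤i , trans (ord'-old j j≤i) ordⱼ≡τ)

  finished : ∀ {i} (S : PartialOrdering i) → (∀ η → ¬ Unchosen S η) → CompleteOrdering K (suc d)
  finished {i} S none = record
    { t = i ; ηs = ord ; simp = simp ; inj = inj ; complete = complete ; surj = chosen }
    where
    open PartialOrdering S
    chosen : ∀ η → Simplex K (suc d) η → Chosen S η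
    chosen η η-simplex with chosen? S η
    ... | yes η-chosen = η-chosen
    ... | no η-unchosen = ⊥-elim (none η (η-simplex , η-unchosen))

  grow : ∀ {i} (S : PartialOrdering i) → Acc _<_ (#unchosen S) → CompleteOrdering K (suc d)
  grow S (acc smaller) with anySubset? (unchosen? S)
  ... | yes (η₀ , η₀-unchosen) = grow (Append.appended S A) (smaller (appending-chooses S A))
    where A = attachable S η₀ η₀-unchosen
  ... | no none = finished S λ η η-unchosen → none (η , η-unchosen)

  start : PartialOrdering 1
  start = record
    { ord = λ _ → proj₁ (Pure.hasTop (SimplicialTree.pure T)) ; 1≤i = ≤-refl
    ; simp = λ _ _ _ → proj₂ (Pure.hasTop (SimplicialTree.pure T))
    ; inj = λ p q 1≤p p≤1 1≤q q≤1 p≢q _ → p≢q (trans (≤-antisym p≤1 1≤p) (≤-antisym 1≤q q≤1))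
    ; parent = λ _ 2≤j j≤1 → ⊥-elim (<⇒≱ 2≤j j≤1)
    ; complete = λ _ 2≤j j≤1 → ⊥-elim (<⇒≱ 2≤j j≤1) }

  tree⇒ordering : CompleteOrdering K (suc d)
  tree⇒ordering = grow start (<-wellFounded _)

theorem5p2 : ∀ {v : ℕ} (n : ℕ) (K : Complex v) → 1 ≤ n → IsComplex K → Pure K n →
    (SimplicialTree K n ⇔ CompleteOrdering K n)
theorem5p2 (suc d) K _ isC pure = mk⇔ (tree⇒ordering K d isC) λ O → record
  { pure = pure ; connected = ordering⇒connected K d O isC pure ; acyclic = ordering⇒acyclic K d O }
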